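{- Let $p$ be a prime, $n\ge1$, $R$ an $\mathbb{F}_p$-algebra, $\Lambda$ an indeterminate, and in the ring $R[\Lambda,1/\Lambda][X_1,X_T,\dots,X_{T^{p^n-1}},1/\Delta_{(\Lambda)}]$ with $\Delta_{(\Lambda)}=\prod_{l=0}^{p^n-1}D_l$, $D_l=\sum_{k=0}^l\binom{l}{k}\Lambda^kX_{T^k}$ ($X_{T^0}=X_1$), define $$P_{(\Lambda)}(X_T^2)=\frac{1}{\Lambda^2}\Big\{\frac{(X_1+\Lambda X_T)^2X_1}{D_2}-X_1^2\Big\}$$ and, for $3\le s\le p^n-1$, $$P_{(\Lambda)}(X_T^s)=\frac{1}{\Lambda^s}\Big\{\frac{(X_1+\Lambda X_T)^sX_1}{D_s}-X_1^s-\sum_{k=2}^{s-1}\binom{s}{k}\Lambda^kX_1^{s-k}P_{(\Lambda)}(X_T^k)\Big\}.$$ Then for $2\le s\le p^n-1$, $P_{(\Lambda)}(X_T^s)$ lies in the subring $R[\Lambda][X_1,X_T,\dots,X_{T^{p^n-1}},1/\Delta_{(\Lambda)}]$.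
   Context: $X_1,X_T,\dots,X_{T^{p^n-1}}$ are independent indeterminates; the ring $R[\Lambda,1/\Lambda][X_1,\dots,X_{T^{p^n-1}},1/\Delta_{(\Lambda)}]$ is the coordinate ring of the unit group scheme of the group algebra of the group scheme $\mathrm{Spec}\,R[\Lambda,1/\Lambda][T]/(T^{p^n})$ with comultiplication $T\mapsto T\otimes1+1\otimes T+\Lambda T\otimes T$. -}

module Defs where

open import Level using (Level; Lift; lift; _⊔_)
open import Algebra.Bundles using (CommutativeRing)
open import Data.Nat using (ℕ; zero; suc; _≤_; _<_; _≟_; _<?_; _^_; _∸_)
  renaming (_+_ to _+ℕ_)
open import Data.Nat.Combinatorics using (_C_)
open import Data.Fin using (Fin; fromℕ<)
  renaming (zero to fzero; suc to fsuc)
open import Data.List using (List; []; _∷_; map)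
open import Data.Product using (_×_; ∃; ∃-syntax; _,_)
open import Data.Unit using (⊤)
open import Relation.Nullary using (yes; no)

-- Everything is relative to a commutative ring R (later assumed of
-- characteristic p, i.e. an F_p-algebra) and the parameters p, n.
module Construction {c ℓ : Level} (R : CommutativeRing c ℓ) (p n : ℕ) where
  module R = CommutativeRing R

  -- Polynomial rings R[Y_0,...,Y_{k-1}] in dense recursive form:
  -- Poly (suc k) = polynomials in Y_0 with coefficients in Poly k
  -- (coefficient list, lowest degree first, trailing zeros ignored).
  Poly : ℕ → Set c
  Poly zero = R.Carrier
  Poly (suc k) = List (Poly k)

  zeroP : ∀ k → Poly k
  zeroP zero = R.0#
  zeroP (suc k) = []

  constP : ∀ k → R.Carrier → Poly k
  constP zero r = r
  constP (suc k) r = constP k r ∷ []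

  oneP : ∀ k → Poly k
  oneP k = constP k R.1#

  EqP : ∀ k → Poly k → Poly k → Set ℓ
  EqP zero a b = a R.≈ b
  EqP (suc k) [] [] = Lift ℓ ⊤
  EqP (suc k) [] (b ∷ bs) = EqP k (zeroP k) b × EqP (suc k) [] bs
  EqP (suc k) (a ∷ as) [] = EqP k a (zeroP k) × EqP (suc k) as []
  EqP (suc k) (a ∷ as) (b ∷ bs) = EqP k a b × EqP (suc k) as bs

  addP : ∀ k → Poly k → Poly k → Poly k
  addP zero a b = a R.+ b
  addP (suc k) [] bs = bs
  addP (suc k) (a ∷ as) [] = a ∷ as
  addP (suc k) (a ∷ as) (b ∷ bs) = addP k a b ∷ addP (suc k) as bs

  negP : ∀ k → Poly k → Poly k
  negP zero a = R.- a
  negP (suc k) [] = []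
  negP (suc k) (a ∷ as) = negP k a ∷ negP (suc k) as

  mulP : ∀ k → Poly k → Poly k → Poly k
  mulP zero a b = a R.* b
  mulP (suc k) [] bs = []
  mulP (suc k) (a ∷ as) bs =
    addP (suc k) (map (mulP k a) bs) (zeroP k ∷ mulP (suc k) as bs)

  varP : ∀ {k} → Fin k → Poly k
  varP {suc k} fzero = zeroP k ∷ oneP k ∷ []
  varP {suc k} (fsuc i) = varP i ∷ []

  -- The polynomial ring A = R[Λ, X_1, X_T, ..., X_{T^{p^n-1}}]:
  -- variable Y_0 = Λ, variable Y_{1+k} = X_{T^k}.
  N : ℕ
  N = p ^ n

  V : ℕ
  V = suc N

  A : Set c
  A = Poly V

  _≈A_ : A → A → Set ℓ
  _≈A_ = EqP V

  _+A_ _*A_ _-A_ : A → A → A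
  _+A_ = addP V
  _*A_ = mulP V
  a -A b = addP V a (negP V b)

  0A 1A : A
  0A = zeroP V
  1A = oneP V

  _^A_ : A → ℕ → A
  a ^A zero = 1A
  a ^A suc m = a *A (a ^A m)

  ℕ→R : ℕ → R.Carrier
  ℕ→R zero = R.0#
  ℕ→R (suc m) = R.1# R.+ ℕ→R m

  natA : ℕ → A
  natA m = constP V (ℕ→R m)

  sumA : ℕ → (ℕ → A) → A
  sumA zero f = 0A
  sumA (suc m) f = sumA m f +A f m

  prodA : ℕ → (ℕ → A) → A
  prodA zero f = 1A
  prodA (suc m) f = prodA m f *A f m

  Λ : A
  Λ = varP {V} fzero

  -- X_{T^k} for k < p^n (junk value 0 otherwise; never used)
  XT : ℕ → A
  XT k with k <? N
  ... | yes k<N = varP {V} (fsuc (fromℕ< k<N))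
  ... | no _ = 0A

  X₁ : A
  X₁ = XT 0

  D : ℕ → A
  D l = sumA (suc l) (λ k → natA (l C k) *A ((Λ ^A k) *A XT k))

  Δ : A
  Δ = prodA N D

  Dexcept : ℕ → A
  Dexcept s = prodA N (λ l → help l (l ≟ s))
    where
    help : ∀ l → _ → A
    help l (yes _) = 1A
    help l (no _) = D l

  -- The localization L = A[1/Λ, 1/Δ] = R[Λ,1/Λ][X_1,...,1/Δ_(Λ)]:
  -- a fraction a / (Λ^i Δ^j).
  record L : Set c where
    constructor _/[Λ^_Δ^_]
    field
      num : A
      eΛ : ℕ
      eΔ : ℕ
  open L public

  den : L → A
  den x = (Λ ^A eΛ x) *A (Δ ^A eΔ x)

  _≈L_ : L → L → Set ℓ
  x ≈L y = ∃[ u ] ∃[ v ]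
    (((Λ ^A u) *A (Δ ^A v)) *A ((num x *A den y) -A (num y *A den x))) ≈A 0A

  _+L_ _*L_ _-L_ : L → L → L
  x +L y = ((num x *A den y) +A (num y *A den x))
             /[Λ^ eΛ x +ℕ eΛ y Δ^ eΔ x +ℕ eΔ y ]
  x *L y = (num x *A num y) /[Λ^ eΛ x +ℕ eΛ y Δ^ eΔ x +ℕ eΔ y ]
  x -L y = ((num x *A den y) -A (num y *A den x))
             /[Λ^ eΛ x +ℕ eΛ y Δ^ eΔ x +ℕ eΔ y ]

  ι : A → L
  ι a = a /[Λ^ 0 Δ^ 0 ]

  0L : L
  0L = ι 0A

  invΛ^ : ℕ → L
  invΛ^ s = 1A /[Λ^ s Δ^ 0 ]

  invD : ℕ → L
  invD s = Dexcept s /[Λ^ 0 Δ^ 1 ]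

  sumL : ℕ → (ℕ → L) → L
  sumL zero f = 0L
  sumL (suc m) f = sumL m f +L f m

  -- The elements P_(Λ)(X_T^s), defined by course-of-values recursion.
  -- For s = 2 the sum below is empty, giving the paper's formula for s = 2.
  step : ℕ → (ℕ → L) → L
  step s prev =
    invΛ^ s *L
      ((((ι (((X₁ +A (Λ *A XT 1)) ^A s) *A X₁)) *L invD s)
         -L ι (X₁ ^A s))
        -L sumL (s ∸ 2)
             (λ j → (ι ((natA (s C (2 +ℕ j)) *A (Λ ^A (2 +ℕ j)))
                         *A (X₁ ^A (s ∸ (2 +ℕ j)))))
                    *L prev (2 +ℕ j)))

  -- table m k = P k for k < m
  table : ℕ → ℕ → L
  table zero k = 0L
  table (suc m) k with k ≟ m
  ... | yes _ = step m (table m)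
  ... | no _ = table m k

  P : ℕ → L
  P s = table (suc s) s

  InSubring : L → Set (c ⊔ ℓ)
  InSubring x = ∃[ b ] ∃[ m ] (x ≈L (b /[Λ^ 0 Δ^ m ]))

-- Work in L = R[Λ, 1/Λ][X, 1/Δ] and write x_j for X_{T^j}. Put ρ = 1 + Λ x₁ / D₀ and
-- G k = ρ^k x₀ / D_k, so that G 0 = G 1 = 1. Unwinding the recursion gives P(X_T^s) = x₀^s γ_s,
-- where γ_k is the k-th divided difference of G at 0 with step Λ (Newton's forward formula
-- G s = Σ_k C(s,k) Λ^k γ_k absorbs the subtracted terms). It remains to see that no γ_k involves 1/Λ.
-- Divided differences of products obey the Leibniz rule, the j-th ones of k ↦ ρ^k are (x₁/D₀)^j ρ^k,
-- and those of the binomial sums l ↦ D_l = Σ_k C(l,k) Λ^k x_k are again binomial sums. Finally 1/D_k is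
-- such a product over Δ: in characteristic p, C(p^n, j) = 0 for 0 < j < p^n, so l ↦ D_l has
-- period p^n and D_k · Π_{0<i<p^n} D_{k+i} = Δ.

module Submission where

open import Algebra.Bundles using (CommutativeRing)
open import Data.Nat.Base using (ℕ)

module IntegerSolver {c ℓ} (R : CommutativeRing c ℓ) where
  open import Algebra.Solver.Ring.AlmostCommutativeRing
    using (fromCommutativeRing; _-Raw-AlmostCommutative⟶_)
  import Algebra.Solver.Ring
  open import Data.Integer.Base as ℤ using (ℤ; +_; -[1+_]; _⊖_; sign; ∣_∣; _◃_)
  import Data.Integer.Properties as ℤ
  open import Data.Maybe.Base using (Maybe; just; nothing)
  open import Data.Nat.Base as ℕ using (zero; suc)
  import Data.Nat.Properties as ℕ
  open import Data.Sign.Base as Sign using (Sign)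
  open import Relation.Nullary.Decidable.Core using (yes; no)
  open import Relation.Binary.PropositionalEquality.Core as ≡ using (_≡_)

  open CommutativeRing R
  open import Algebra.Properties.Ring ring
    using (-‿involutive; -‿distribˡ-*; -0#≈0#; -‿+-comm)
  open import Algebra.Properties.Semiring.Mult.TCOptimised semiring using (_×_; ×-homo-+; ×1-homo-*)
  open import Algebra.Properties.CommutativeSemigroup +-commutativeSemigroup
    using () renaming (interchange to +-interchange)
  open import Algebra.Properties.CommutativeSemigroup *-commutativeSemigroup
    using () renaming (interchange to *-interchange)
  open import Relation.Binary.Reasoning.Setoid setoid

  ⟦_⟧ℤ : ℤ → Carrier
  ⟦ + n ⟧ℤ = n × 1#
  ⟦ -[1+ n ] ⟧ℤ = - (suc n × 1#)

  private
    ⊖-homo : ∀ m n → ⟦ m ⊖ n ⟧ℤ ≈ m × 1# - n × 1#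
    ⊖-homo zero zero = sym (trans (+-congˡ -0#≈0#) (+-identityʳ _))
    ⊖-homo (suc m) zero = sym (trans (+-congˡ -0#≈0#) (+-identityʳ _))
    ⊖-homo zero (suc n) = sym (+-identityˡ _)
    ⊖-homo (suc m) (suc n) = begin
      ⟦ suc m ⊖ suc n ⟧ℤ                   ≡⟨ ≡.cong ⟦_⟧ℤ (ℤ.[1+m]⊖[1+n]≡m⊖n m n) ⟩
      ⟦ m ⊖ n ⟧ℤ                           ≈⟨ ⊖-homo m n ⟩
      m × 1# - n × 1#                      ≈⟨ +-identityˡ _ ⟨
      0# + (m × 1# - n × 1#)               ≈⟨ +-congʳ (-‿inverseʳ 1#) ⟨
      (1# - 1#) + (m × 1# - n × 1#)        ≈⟨ +-interchange 1# (m × 1#) (- 1#) (- (n × 1#)) ⟨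
      (1# + m × 1#) + (- 1# - n × 1#)      ≈⟨ +-congˡ (-‿+-comm 1# (n × 1#)) ⟩
      (1# + m × 1#) - (1# + n × 1#)        ≈⟨ +-cong (×-homo-+ 1# 1 m) (-‿cong (×-homo-+ 1# 1 n)) ⟨
      suc m × 1# - suc n × 1#              ∎

    +-homo : ∀ i j → ⟦ i ℤ.+ j ⟧ℤ ≈ ⟦ i ⟧ℤ + ⟦ j ⟧ℤ
    +-homo -[1+ m ] -[1+ n ] = begin
      - (suc (suc m ℕ.+ n) × 1#)          ≡⟨ ≡.cong (λ k → - (k × 1#)) (≡.sym (ℕ.+-suc (suc m) n)) ⟩
      - ((suc m ℕ.+ suc n) × 1#)          ≈⟨ -‿cong (×-homo-+ 1# (suc m) (suc n)) ⟩
      - (suc m × 1# + suc n × 1#)         ≈⟨ -‿+-comm _ _ ⟨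
      - (suc m × 1#) - (suc n × 1#)       ∎
    +-homo -[1+ m ] (+ n) = trans (⊖-homo n (suc m)) (+-comm _ _)
    +-homo (+ m) -[1+ n ] = ⊖-homo m (suc n)
    +-homo (+ m) (+ n) = ×-homo-+ 1# m n

    ⟦_⟧± : Sign → Carrier
    ⟦ Sign.+ ⟧± = 1#
    ⟦ Sign.- ⟧± = - 1#

    sign-homo : ∀ s t → ⟦ s Sign.* t ⟧± ≈ ⟦ s ⟧± * ⟦ t ⟧±
    sign-homo Sign.+ t = sym (*-identityˡ _)
    sign-homo Sign.- Sign.+ = sym (*-identityʳ _)
    sign-homo Sign.- Sign.- = begin
      1#                ≈⟨ -‿involutive 1# ⟨
      - - 1#            ≈⟨ -‿cong (-‿cong (*-identityˡ _)) ⟨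
      - - (1# * 1#)     ≈⟨ -‿cong (-‿distribˡ-* _ _) ⟩
      - (- 1# * 1#)     ≈⟨ -‿cong (*-comm _ _) ⟩
      - (1# * - 1#)     ≈⟨ -‿distribˡ-* _ _ ⟩
      - 1# * - 1#       ∎

    ◃-homo : ∀ s n → ⟦ s ◃ n ⟧ℤ ≈ ⟦ s ⟧± * (n × 1#)
    ◃-homo s zero = sym (zeroʳ _)
    ◃-homo Sign.+ (suc n) = sym (*-identityˡ _)
    ◃-homo Sign.- (suc n) = trans (-‿cong (sym (*-identityˡ _))) (-‿distribˡ-* _ _)

    sign-abs : ∀ i → ⟦ i ⟧ℤ ≈ ⟦ sign i ⟧± * (∣ i ∣ × 1#)
    sign-abs (+ n) = sym (*-identityˡ _)
    sign-abs -[1+ n ] = ◃-homo Sign.- (suc n)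

    *-homo : ∀ i j → ⟦ i ℤ.* j ⟧ℤ ≈ ⟦ i ⟧ℤ * ⟦ j ⟧ℤ
    *-homo i j = begin
      ⟦ sign i Sign.* sign j ◃ ∣ i ∣ ℕ.* ∣ j ∣ ⟧ℤ
        ≈⟨ ◃-homo (sign i Sign.* sign j) (∣ i ∣ ℕ.* ∣ j ∣) ⟩
      ⟦ sign i Sign.* sign j ⟧± * ((∣ i ∣ ℕ.* ∣ j ∣) × 1#)
        ≈⟨ *-cong (sign-homo (sign i) (sign j)) (×1-homo-* ∣ i ∣ ∣ j ∣) ⟩
      (⟦ sign i ⟧± * ⟦ sign j ⟧±) * ((∣ i ∣ × 1#) * (∣ j ∣ × 1#))
        ≈⟨ *-interchange _ _ _ _ ⟩
      (⟦ sign i ⟧± * (∣ i ∣ × 1#)) * (⟦ sign j ⟧± * (∣ j ∣ × 1#))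
        ≈⟨ *-cong (sign-abs i) (sign-abs j) ⟨
      ⟦ i ⟧ℤ * ⟦ j ⟧ℤ ∎

    -‿homo : ∀ i → ⟦ ℤ.- i ⟧ℤ ≈ - ⟦ i ⟧ℤ
    -‿homo -[1+ n ] = sym (-‿involutive _)
    -‿homo (+ zero) = sym -0#≈0#
    -‿homo (+ suc n) = refl

    homomorphism : CommutativeRing.rawRing ℤ.+-*-commutativeRing
                     -Raw-AlmostCommutative⟶ fromCommutativeRing R
    homomorphism = record
      { ⟦_⟧ = ⟦_⟧ℤ ; +-homo = +-homo ; *-homo = *-homo ; -‿homo = -‿homo
      ; 0-homo = refl ; 1-homo = refl }

    _≟ℤ_ : ∀ i j → Maybe (⟦ i ⟧ℤ ≈ ⟦ j ⟧ℤ)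
    i ≟ℤ j with i ℤ.≟ j
    ... | yes ≡.refl = just refl
    ... | no _ = nothing

  open Algebra.Solver.Ring _ _ homomorphism _≟ℤ_ public

module PrimePowerBinomial where
  open import Data.Nat.Base
  open import Data.Nat.Properties
  open import Data.Nat.Divisibility
  open import Data.Nat.Primality using (Prime; euclidsLemma; prime⇒nonZero)
  open import Data.Nat.Combinatorics using (_C_; k![n∸k]!∣n!)
  open import Data.Nat.Combinatorics.Specification using (nCk≡n!/k![n-k]!; k>n⇒nCk≡0)
  open import Data.Nat.DivMod using (m/n*n≡m)
  open import Data.Nat.Tactic.RingSolver using (solve-∀)
  open import Data.Sum.Base using (inj₁; inj₂)
  open import Relation.Nullary.Decidable.Core using (yes; no)
  open import Relation.Nullary.Negation.Core using (contradiction)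
  open import Relation.Binary.PropositionalEquality

  C*factorials≡! : ∀ {n k} → k ≤ n → (n C k) * (k ! * (n ∸ k) !) ≡ n !
  C*factorials≡! {n} {k} k≤n = begin
    (n C k) * (k ! * (n ∸ k) !)                          ≡⟨ cong (_* (k ! * (n ∸ k) !)) (nCk≡n!/k![n-k]! k≤n) ⟩
    (n ! / (k ! * (n ∸ k) !)) * (k ! * (n ∸ k) !)        ≡⟨ m/n*n≡m (k![n∸k]!∣n! k≤n) ⟩
    n !                                                  ∎
    where
    open ≡-Reasoning
    instance _ = k !* (n ∸ k) !≢0

  suc-*-C : ∀ n k → suc k * (suc n C suc k) ≡ suc n * (n C k)
  suc-*-C n k with k ≤? n
  ... | no k≰n = begin
    suc k * (suc n C suc k) ≡⟨ cong (suc k *_) (k>n⇒nCk≡0 (s≤s (≰⇒> k≰n))) ⟩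
    suc k * 0               ≡⟨ *-zeroʳ (suc k) ⟩
    0                       ≡⟨ *-zeroʳ (suc n) ⟨
    suc n * 0               ≡⟨ cong (suc n *_) (k>n⇒nCk≡0 (≰⇒> k≰n)) ⟨
    suc n * (n C k)         ∎
    where open ≡-Reasoning
  ... | yes k≤n = *-cancelʳ-≡ _ _ (k ! * (n ∸ k) !) {{k !* (n ∸ k) !≢0}} (begin
    suc k * (suc n C suc k) * (k ! * (n ∸ k) !)   ≡⟨ regroup (suc k) (suc n C suc k) (k !) ((n ∸ k) !) ⟩
    (suc n C suc k) * ((suc k) ! * (n ∸ k) !)     ≡⟨ C*factorials≡! (s≤s k≤n) ⟩
    suc n * n !                                   ≡⟨ cong (suc n *_) (C*factorials≡! k≤n) ⟨
    suc n * ((n C k) * (k ! * (n ∸ k) !))         ≡⟨ *-assoc (suc n) (n C k) _ ⟨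
    suc n * (n C k) * (k ! * (n ∸ k) !)           ∎)
    where
    open ≡-Reasoning
    regroup : ∀ a b x y → a * b * (x * y) ≡ b * ((a * x) * y)
    regroup = solve-∀

  prime-power∣*⇒prime∣ : ∀ {p} → Prime p → ∀ n {j c} → 0 < j → j < p ^ n → p ^ n ∣ j * c → p ∣ c
  prime-power∣*⇒prime∣ p-prime zero 0<j j<1 _ = contradiction (≤-pred j<1) (<⇒≱ 0<j)
  prime-power∣*⇒prime∣ {p} p-prime (suc n) {j} {c} 0<j j<p^[1+n] p^n∣jc
    with euclidsLemma j c p-prime (∣-trans (m∣m*n (p ^ n)) p^n∣jc)
  ... | inj₂ p∣c = p∣c
  ... | inj₁ (divides q j≡qp) = prime-power∣*⇒prime∣ p-prime n 0<q q<p^n p^n∣qc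
    where
    instance _ = prime⇒nonZero p-prime
    p^n∣qc : p ^ n ∣ q * c
    p^n∣qc = *-cancelˡ-∣ p (subst (p * p ^ n ∣_) (begin
      j * c       ≡⟨ cong (_* c) (trans j≡qp (*-comm q p)) ⟩
      p * q * c   ≡⟨ *-assoc p q c ⟩
      p * (q * c) ∎) p^n∣jc)
      where open ≡-Reasoning
    0<q : 0 < q
    0<q = n≢0⇒n>0 λ { refl → contradiction (subst (0 <_) j≡qp 0<j) (<-irrefl refl) }
    q<p^n : q < p ^ n
    q<p^n = *-cancelʳ-< p q (p ^ n) (subst₂ _<_ j≡qp (*-comm p (p ^ n)) j<p^[1+n])

  prime∣prime-power-C : ∀ {p} → Prime p → ∀ n {j} → 0 < j → j < p ^ n → p ∣ (p ^ n) C j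
  prime∣prime-power-C {p} p-prime n {suc k} 0<j j<p^n with p ^ n in p^n≡
  ... | zero = contradiction j<p^n λ ()
  ... | suc m = prime-power∣*⇒prime∣ p-prime n 0<j (subst (suc k <_) (sym p^n≡) j<p^n)
                  (subst (λ t → t ∣ suc k * (suc m C suc k)) (sym p^n≡)
                    (divides (m C k) (trans (suc-*-C m k) (*-comm (suc m) (m C k)))))

module FiniteDifferences {c ℓ} (R : CommutativeRing c ℓ) where
  open import Level using (_⊔_)
  open import Data.Integer.Base using (+_)
  open import Data.Nat.Base as ℕ using (ℕ; zero; suc; _≤_; _<_; z≤n; s≤s)
  import Data.Nat.Properties as ℕ
  open import Data.Nat.Combinatorics using (_C_; nCk+nC[k+1]≡[n+1]C[k+1])
  open import Data.Nat.Combinatorics.Specification using (k>n⇒nCk≡0)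
  open import Relation.Binary.PropositionalEquality.Core as ≡ using (_≡_)
  open import Relation.Nullary.Decidable.Core using (yes; no)
  open import Relation.Nullary.Negation.Core using (¬_)

  open CommutativeRing R
  open import Algebra.Properties.Semiring.Mult semiring using (_×_; ×-homo-+; ×-congˡ)
  open import Algebra.Properties.Semiring.Exp semiring using (_^_)
  open IntegerSolver R using (solve; _:+_; _:*_; _:-_; _:=_; con)
  open import Relation.Binary.Reasoning.Setoid setoid

  sum : ℕ → (ℕ → Carrier) → Carrier
  sum zero f = 0#
  sum (suc m) f = sum m f + f m

  prod : ℕ → (ℕ → Carrier) → Carrier
  prod zero f = 1#
  prod (suc m) f = prod m f * f m

  sum-cong : ∀ m {f g} → (∀ j → j < m → f j ≈ g j) → sum m f ≈ sum m g
  sum-cong zero _ = refl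
  sum-cong (suc m) f≈g = +-cong (sum-cong m λ j j<m → f≈g j (ℕ.m<n⇒m<1+n j<m)) (f≈g m ℕ.≤-refl)

  sum-+ : ∀ m f g → sum m (λ j → f j + g j) ≈ sum m f + sum m g
  sum-+ zero f g = sym (+-identityˡ 0#)
  sum-+ (suc m) f g = trans (+-congʳ (sum-+ m f g))
    (solve 4 (λ a b x y → (a :+ b) :+ (x :+ y) := (a :+ x) :+ (b :+ y)) refl (sum m f) (sum m g) (f m) (g m))

  sum-*ˡ : ∀ m a f → sum m (λ j → a * f j) ≈ a * sum m f
  sum-*ˡ zero a f = sym (zeroʳ a)
  sum-*ˡ (suc m) a f = trans (+-congʳ (sum-*ˡ m a f)) (sym (distribˡ a (sum m f) (f m)))

  sum-head : ∀ m f → sum (suc m) f ≈ f 0 + sum m (λ j → f (suc j))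
  sum-head zero f = trans (+-identityˡ (f 0)) (sym (+-identityʳ (f 0)))
  sum-head (suc m) f = trans (+-congʳ (sum-head m f)) (+-assoc (f 0) _ (f (suc m)))

  sum-vanishing-tail : ∀ m k f → (∀ j → m ≤ j → f j ≈ 0#) → sum (m ℕ.+ k) f ≈ sum m f
  sum-vanishing-tail m zero f _ = ≡.subst (λ t → sum t f ≈ sum m f) (≡.sym (ℕ.+-identityʳ m)) refl
  sum-vanishing-tail m (suc k) f tail≈0 = ≡.subst (λ t → sum t f ≈ sum m f) (≡.sym (ℕ.+-suc m k)) (begin
    sum (m ℕ.+ k) f + f (m ℕ.+ k) ≈⟨ +-cong (sum-vanishing-tail m k f tail≈0) (tail≈0 (m ℕ.+ k) (ℕ.m≤m+n m k)) ⟩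
    sum m f + 0#                  ≈⟨ +-identityʳ (sum m f) ⟩
    sum m f                       ∎)

  prod-cong : ∀ m {f g} → (∀ j → j < m → f j ≈ g j) → prod m f ≈ prod m g
  prod-cong zero _ = refl
  prod-cong (suc m) f≈g = *-cong (prod-cong m λ j j<m → f≈g j (ℕ.m<n⇒m<1+n j<m)) (f≈g m ℕ.≤-refl)

  prod-head : ∀ m f → prod (suc m) f ≈ f 0 * prod m (λ j → f (suc j))
  prod-head zero f = trans (*-identityˡ (f 0)) (sym (*-identityʳ (f 0)))
  prod-head (suc m) f = trans (*-congʳ (prod-head m f)) (*-assoc (f 0) _ (f (suc m)))

  prod-+ : ∀ a b f → prod (a ℕ.+ b) f ≈ prod a f * prod b (λ i → f (a ℕ.+ i))
  prod-+ a zero f = ≡.subst (λ t → prod t f ≈ prod a f * 1#) (≡.sym (ℕ.+-identityʳ a)) (sym (*-identityʳ _))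
  prod-+ a (suc b) f =
    ≡.subst (λ t → prod t f ≈ prod a f * prod (suc b) (λ i → f (a ℕ.+ i))) (≡.sym (ℕ.+-suc a b))
    (trans (*-congʳ (prod-+ a b f)) (*-assoc (prod a f) _ (f (a ℕ.+ b))))

  prod-punchOut : ∀ m {s} f g → s < m → (∀ l → ¬ l ≡ s → g l ≈ f l) → g s ≈ 1# → prod m g * f s ≈ prod m f
  prod-punchOut (suc m) {s} f g s<1+m g≈f gs≈1 with m ℕ.≟ s
  ... | yes ≡.refl = begin
    (prod m g * g m) * f m
      ≈⟨ *-congʳ (*-cong (prod-cong m λ l l<m → g≈f l λ { ≡.refl → ℕ.<-irrefl ≡.refl l<m }) gs≈1) ⟩
    (prod m f * 1#) * f m  ≈⟨ *-congʳ (*-identityʳ (prod m f)) ⟩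
    prod m f * f m         ∎
  ... | no m≢s = begin
    (prod m g * g m) * f s ≈⟨ solve 3 (λ a b x → (a :* b) :* x := (a :* x) :* b) refl (prod m g) (g m) (f s) ⟩
    (prod m g * f s) * g m ≈⟨ *-cong (prod-punchOut m f g s<m g≈f gs≈1) (g≈f m m≢s) ⟩
    prod m f * f m         ∎
    where s<m = ℕ.≤∧≢⇒< (ℕ.≤-pred s<1+m) (λ s≡m → m≢s (≡.sym s≡m))

  prod-rotate : ∀ N {k} f → (∀ i → f (N ℕ.+ i) ≈ f i) → k ≤ N → prod N (λ i → f (k ℕ.+ i)) ≈ prod N f
  prod-rotate N {k} f periodic k≤N = begin
    prod N g                              ≡⟨ ≡.cong (λ m → prod m g) (ℕ.m∸n+n≡m k≤N) ⟨
    prod ((N ℕ.∸ k) ℕ.+ k) g              ≈⟨ prod-+ (N ℕ.∸ k) k g ⟩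
    prod (N ℕ.∸ k) g * prod k (λ i → g ((N ℕ.∸ k) ℕ.+ i))
      ≈⟨ *-congˡ (prod-cong k λ i _ → wrap-around i) ⟩
    prod (N ℕ.∸ k) g * prod k f           ≈⟨ *-comm (prod (N ℕ.∸ k) g) (prod k f) ⟩
    prod k f * prod (N ℕ.∸ k) g           ≈⟨ prod-+ k (N ℕ.∸ k) f ⟨
    prod (k ℕ.+ (N ℕ.∸ k)) f              ≡⟨ ≡.cong (λ m → prod m f) (ℕ.m+[n∸m]≡n k≤N) ⟩
    prod N f                              ∎
    where
    g = λ i → f (k ℕ.+ i)
    wrap-around : ∀ i → g ((N ℕ.∸ k) ℕ.+ i) ≈ f i
    wrap-around i = trans (reflexive (≡.cong f (≡.trans (≡.sym (ℕ.+-assoc k (N ℕ.∸ k) i))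
                                                        (≡.cong (ℕ._+ i) (ℕ.m+[n∸m]≡n k≤N)))))
                          (periodic i)

  binomialSum : Carrier → (ℕ → Carrier) → ℕ → Carrier
  binomialSum h a l = sum (suc l) (λ j → (l C j) × 1# * (h ^ j * a j))

  binomialSum-0 : ∀ h a → binomialSum h a 0 ≈ a 0
  binomialSum-0 h a = solve 1 (λ x → con (+ 0) :+ c₁ :* (con (+ 1) :* x) := x) refl (a 0)
    where c₁ = con (+ 1) :+ con (+ 0)

  binomialSum-1 : ∀ h a → binomialSum h a 1 ≈ a 0 + h * a 1
  binomialSum-1 h a =
    solve 3 (λ x y h → (con (+ 0) :+ c₁ :* (con (+ 1) :* x)) :+ c₁ :* ((h :* con (+ 1)) :* y) := x :+ h :* y)
      refl (a 0) (a 1) h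
    where c₁ = con (+ 1) :+ con (+ 0)

  binomialSum-cong : ∀ h {a b} l → (∀ j → a j ≈ b j) → binomialSum h a l ≈ binomialSum h b l
  binomialSum-cong h l a≈b = sum-cong (suc l) λ j _ → *-congˡ (*-congˡ (a≈b j))

  binomialSum-+ : ∀ h a b l → binomialSum h (λ j → a j + b j) l ≈ binomialSum h a l + binomialSum h b l
  binomialSum-+ h a b l = trans (sum-cong (suc l) λ j _ →
      solve 4 (λ x y u v → x :* (y :* (u :+ v)) := x :* (y :* u) :+ x :* (y :* v))
        refl ((l C j) × 1#) (h ^ j) (a j) (b j))
    (sum-+ (suc l) _ _)

  binomialSum-*ˡ : ∀ h e a l → binomialSum h (λ j → e * a j) l ≈ e * binomialSum h a l
  binomialSum-*ˡ h e a l = trans (sum-cong (suc l) λ j _ →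
      solve 4 (λ x y e u → x :* (y :* (e :* u)) := e :* (x :* (y :* u))) refl ((l C j) × 1#) (h ^ j) e (a j))
    (sum-*ˡ (suc l) e _)

  binomialSum-suc : ∀ h a l → binomialSum h a (suc l) ≈ binomialSum h a l + h * binomialSum h (λ j → a (suc j)) l
  binomialSum-suc h a l = begin
    binomialSum h a (suc l)                                     ≈⟨ sum-head (suc l) t ⟩
    t 0 + sum (suc l) (λ j → t (suc j))                         ≈⟨ +-congˡ (sum-cong (suc l) λ j _ → pascal j) ⟩
    t 0 + sum (suc l) (λ j → s (suc j) + u j)                   ≈⟨ +-congˡ (sum-+ (suc l) _ u) ⟩
    t 0 + (sum (suc l) (λ j → s (suc j)) + sum (suc l) u)       ≈⟨ +-assoc (t 0) _ _ ⟨
    (s 0 + sum (suc l) (λ j → s (suc j))) + sum (suc l) u       ≈⟨ +-congʳ (sum-head (suc l) s) ⟨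
    (sum (suc l) s + s (suc l)) + sum (suc l) u                 ≈⟨ +-congʳ (+-congˡ last≈0) ⟩
    (binomialSum h a l + 0#) + sum (suc l) u                    ≈⟨ +-congʳ (+-identityʳ _) ⟩
    binomialSum h a l + sum (suc l) u
      ≈⟨ +-congˡ (trans (sum-cong (suc l) λ j _ → pull-h j) (sum-*ˡ (suc l) h _)) ⟩
    binomialSum h a l + h * binomialSum h (λ j → a (suc j)) l   ∎
    where
    t s u : ℕ → Carrier
    t j = (suc l C j) × 1# * (h ^ j * a j)
    s j = (l C j) × 1# * (h ^ j * a j)
    u j = (l C j) × 1# * (h ^ suc j * a (suc j))
    pascal : ∀ j → t (suc j) ≈ s (suc j) + u j
    pascal j = begin
      (suc l C suc j) × 1# * (h ^ suc j * a (suc j))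
        ≈⟨ *-congʳ (×-congˡ (nCk+nC[k+1]≡[n+1]C[k+1] l j)) ⟨
      (l C j ℕ.+ l C suc j) × 1# * (h ^ suc j * a (suc j))
        ≈⟨ *-congʳ (×-homo-+ 1# (l C j) (l C suc j)) ⟩
      ((l C j) × 1# + (l C suc j) × 1#) * (h ^ suc j * a (suc j))
        ≈⟨ distribʳ _ _ _ ⟩
      u j + s (suc j)  ≈⟨ +-comm (u j) (s (suc j)) ⟩
      s (suc j) + u j ∎
    last≈0 : s (suc l) ≈ 0#
    last≈0 = trans (*-congʳ (×-congˡ (k>n⇒nCk≡0 (ℕ.n<1+n l)))) (zeroˡ _)
    pull-h : ∀ j → u j ≈ h * ((l C j) × 1# * (h ^ j * a (suc j)))
    pull-h j = solve 4 (λ x y w z → x :* ((y :* w) :* z) := y :* (x :* (w :* z)))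
      refl ((l C j) × 1#) h (h ^ j) (a (suc j))

  C-periodic : ∀ N → (∀ j → 0 < j → j < N → (N C j) × 1# ≈ 0#) →
               ∀ i j → j < N → ((N ℕ.+ i) C j) × 1# ≈ (i C j) × 1#
  C-periodic N NCj≈0 zero zero _ = reflexive (≡.cong (λ t → (t C 0) × 1#) (ℕ.+-identityʳ N))
  C-periodic N NCj≈0 zero (suc j) j<N =
    trans (reflexive (≡.cong (λ t → (t C suc j) × 1#) (ℕ.+-identityʳ N))) (NCj≈0 (suc j) (s≤s z≤n) j<N)
  C-periodic N NCj≈0 (suc i) zero _ = reflexive (≡.cong (λ t → (t C 0) × 1#) (ℕ.+-suc N i))
  C-periodic N NCj≈0 (suc i) (suc j) j<N =
    ≡.subst (λ t → (t C suc j) × 1# ≈ (suc i C suc j) × 1#) (≡.sym (ℕ.+-suc N i)) (begin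
    (suc (N ℕ.+ i) C suc j) × 1#                          ≈⟨ ×-congˡ (nCk+nC[k+1]≡[n+1]C[k+1] (N ℕ.+ i) j) ⟨
    ((N ℕ.+ i) C j ℕ.+ (N ℕ.+ i) C suc j) × 1#            ≈⟨ ×-homo-+ 1# ((N ℕ.+ i) C j) ((N ℕ.+ i) C suc j) ⟩
    ((N ℕ.+ i) C j) × 1# + ((N ℕ.+ i) C suc j) × 1#
      ≈⟨ +-cong (C-periodic N NCj≈0 i j (ℕ.<-trans (ℕ.n<1+n j) j<N)) (C-periodic N NCj≈0 i (suc j) j<N) ⟩
    (i C j) × 1# + (i C suc j) × 1#                       ≈⟨ ×-homo-+ 1# (i C j) (i C suc j) ⟨
    (i C j ℕ.+ i C suc j) × 1#                            ≈⟨ ×-congˡ (nCk+nC[k+1]≡[n+1]C[k+1] i j) ⟩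
    (suc i C suc j) × 1#                                  ∎)

  binomialSum-periodic : ∀ h a N → (∀ j → 0 < j → j < N → (N C j) × 1# ≈ 0#) → (∀ j → N ≤ j → a j ≈ 0#) →
                         ∀ i → binomialSum h a (N ℕ.+ i) ≈ binomialSum h a i
  binomialSum-periodic h a N NCj≈0 a≈0 i = begin
    sum (suc (N ℕ.+ i)) t         ≡⟨ ≡.cong (λ m → sum m t) (ℕ.+-suc N i) ⟨
    sum (N ℕ.+ suc i) t           ≈⟨ sum-vanishing-tail N (suc i) t (λ j N≤j → vanish ((N ℕ.+ i) C j) j N≤j) ⟩
    sum N t                       ≈⟨ sum-cong N (λ j j<N → *-congʳ (C-periodic N NCj≈0 i j j<N)) ⟩
    sum N s                       ≈⟨ sum-vanishing-tail N (suc i) s (λ j N≤j → vanish (i C j) j N≤j) ⟨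
    sum (N ℕ.+ suc i) s           ≡⟨ ≡.cong (λ m → sum m s) (ℕ.+-comm N (suc i)) ⟩
    sum (suc i ℕ.+ N) s
      ≈⟨ sum-vanishing-tail (suc i) N s (λ j i<j → trans (*-congʳ (×-congˡ (k>n⇒nCk≡0 i<j))) (zeroˡ _)) ⟩
    binomialSum h a i             ∎
    where
    t s : ℕ → Carrier
    t j = ((N ℕ.+ i) C j) × 1# * (h ^ j * a j)
    s j = (i C j) × 1# * (h ^ j * a j)
    vanish : ∀ m j → N ≤ j → m × 1# * (h ^ j * a j) ≈ 0#
    vanish m j N≤j = trans (*-congˡ (trans (*-congˡ (a≈0 j N≤j)) (zeroʳ (h ^ j)))) (zeroʳ (m × 1#))

  record IsSubsemiring {b} (B : Carrier → Set b) : Set (c ⊔ ℓ ⊔ b) where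
    field
      ∈-resp-≈ : ∀ {x y} → x ≈ y → B x → B y
      0∈ : B 0#
      1∈ : B 1#
      +-closed : ∀ {x y} → B x → B y → B (x + y)
      *-closed : ∀ {x y} → B x → B y → B (x * y)

    ^-closed : ∀ {x} m → B x → B (x ^ m)
    ^-closed zero _ = 1∈
    ^-closed (suc m) x∈B = *-closed x∈B (^-closed m x∈B)

    ×1-closed : ∀ m → B (m × 1#)
    ×1-closed zero = 0∈
    ×1-closed (suc m) = +-closed 1∈ (×1-closed m)

    sum-closed : ∀ m {f} → (∀ j → B (f j)) → B (sum m f)
    sum-closed zero _ = 0∈
    sum-closed (suc m) f∈B = +-closed (sum-closed m f∈B) (f∈B m)

  module DividedDifferences (h h⁻¹ : Carrier) (hh⁻¹≈1 : h * h⁻¹ ≈ 1#) where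

    ∇ : (ℕ → Carrier) → ℕ → Carrier
    ∇ f y = h⁻¹ * (f (suc y) - f y)

    ∇^ : ℕ → (ℕ → Carrier) → ℕ → Carrier
    ∇^ zero f = f
    ∇^ (suc k) f = ∇ (∇^ k f)

    ∇-cong : ∀ {f g} → (∀ y → f y ≈ g y) → ∀ x → ∇ f x ≈ ∇ g x
    ∇-cong f≈g x = *-congˡ (+-cong (f≈g (suc x)) (-‿cong (f≈g x)))

    ∇^-cong : ∀ k {f g} → (∀ y → f y ≈ g y) → ∀ x → ∇^ k f x ≈ ∇^ k g x
    ∇^-cong zero f≈g = f≈g
    ∇^-cong (suc k) f≈g = ∇-cong (∇^-cong k f≈g)

    ∇^-shift : ∀ k f x → ∇^ k (λ y → f (suc y)) x ≡ ∇^ k f (suc x)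
    ∇^-shift zero f x = ≡.refl
    ∇^-shift (suc k) f x = ≡.cong₂ (λ a b → h⁻¹ * (a - b)) (∇^-shift k f (suc x)) (∇^-shift k f x)

    ∇^-suc : ∀ k f x → ∇^ (suc k) f x ≈ ∇^ k (∇ f) x
    ∇^-suc zero f x = refl
    ∇^-suc (suc k) f x = ∇-cong (∇^-suc k f) x

    ∇^-+ : ∀ k f g x → ∇^ k (λ y → f y + g y) x ≈ ∇^ k f x + ∇^ k g x
    ∇^-+ zero f g x = refl
    ∇^-+ (suc k) f g x = trans (∇-cong (∇^-+ k f g) x)
      (solve 5 (λ m a b a' b' → m :* ((a :+ b) :- (a' :+ b')) := m :* (a :- a') :+ m :* (b :- b'))
        refl h⁻¹ (∇^ k f (suc x)) (∇^ k g (suc x)) (∇^ k f x) (∇^ k g x))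

    ∇^-*ˡ : ∀ k a f x → ∇^ k (λ y → a * f y) x ≈ a * ∇^ k f x
    ∇^-*ˡ zero a f x = refl
    ∇^-*ˡ (suc k) a f x = trans (∇-cong (∇^-*ˡ k a f) x)
      (solve 4 (λ m a u v → m :* (a :* u :- a :* v) := a :* (m :* (u :- v)))
        refl h⁻¹ a (∇^ k f (suc x)) (∇^ k f x))

    ∇^-const : ∀ k a x → ∇^ (suc k) (λ _ → a) x ≈ 0#
    ∇^-const zero a x = trans (*-congˡ (-‿inverseʳ a)) (zeroʳ h⁻¹)
    ∇^-const (suc k) a x = trans (∇-cong (∇^-const k a) x)
      (solve 1 (λ m → m :* (con (+ 0) :- con (+ 0)) := con (+ 0)) refl h⁻¹)

    ∇-* : ∀ f g y → ∇ (λ z → f z * g z) y ≈ ∇ f y * g (suc y) + f y * ∇ g y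
    ∇-* f g y = solve 5 (λ m a b x w → m :* (a :* b :- x :* w) := m :* (a :- x) :* b :+ x :* (m :* (b :- w)))
      refl h⁻¹ (f (suc y)) (g (suc y)) (f y) (g y)

    private
      h⁻¹-cancel : ∀ x → h⁻¹ * (h * x) ≈ x
      h⁻¹-cancel x = trans (sym (*-assoc h⁻¹ h x)) (trans (*-congʳ (trans (*-comm h⁻¹ h) hh⁻¹≈1)) (*-identityˡ x))

    ∇-step : ∀ f x → f (suc x) ≈ f x + h * ∇ f x
    ∇-step f x = sym (begin
      f x + h * (h⁻¹ * (f (suc x) - f x)) ≈⟨ +-congˡ (*-assoc h h⁻¹ _) ⟨
      f x + (h * h⁻¹) * (f (suc x) - f x) ≈⟨ +-congˡ (*-congʳ hh⁻¹≈1) ⟩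
      f x + 1# * (f (suc x) - f x)
        ≈⟨ solve 2 (λ a b → b :+ con (+ 1) :* (a :- b) := a) refl (f (suc x)) (f x) ⟩
      f (suc x)                           ∎)

    ∇^-geometric : ∀ e k x → ∇^ k (λ y → (1# + h * e) ^ y) x ≈ e ^ k * (1# + h * e) ^ x
    ∇^-geometric e zero x = sym (*-identityˡ _)
    ∇^-geometric e (suc k) x = begin
      ∇ (∇^ k (ρ ^_)) x             ≈⟨ ∇-cong (∇^-geometric e k) x ⟩
      ∇ (λ y → e ^ k * ρ ^ y) x    ≈⟨ ∇^-*ˡ 1 (e ^ k) (ρ ^_) x ⟩
      e ^ k * ∇ (ρ ^_) x
        ≈⟨ *-congˡ (*-congˡ (solve 3 (λ h e q → (con (+ 1) :+ h :* e) :* q :- q := h :* (e :* q))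
                                     refl h e (ρ ^ x))) ⟩
      e ^ k * (h⁻¹ * (h * (e * ρ ^ x)))  ≈⟨ *-congˡ (h⁻¹-cancel (e * ρ ^ x)) ⟩
      e ^ k * (e * ρ ^ x)
        ≈⟨ solve 3 (λ a e q → a :* (e :* q) := (e :* a) :* q) refl (e ^ k) e (ρ ^ x) ⟩
      e ^ suc k * ρ ^ x            ∎
      where ρ = 1# + h * e

    ∇^-binomialSum : ∀ k a t x →
                     ∇^ k (λ z → binomialSum h a (z ℕ.+ t)) x ≈ binomialSum h (λ j → a (k ℕ.+ j)) (x ℕ.+ t)
    ∇^-binomialSum zero a t x = refl
    ∇^-binomialSum (suc k) a t x = begin
      ∇ (∇^ k (λ z → binomialSum h a (z ℕ.+ t))) x                  ≈⟨ ∇-cong (∇^-binomialSum k a t) x ⟩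
      h⁻¹ * (binomialSum h a′ (suc x ℕ.+ t) - binomialSum h a′ (x ℕ.+ t))
        ≈⟨ *-congˡ (+-congʳ (binomialSum-suc h a′ (x ℕ.+ t))) ⟩
      h⁻¹ * ((binomialSum h a′ (x ℕ.+ t) + h * binomialSum h (λ j → a′ (suc j)) (x ℕ.+ t))
             - binomialSum h a′ (x ℕ.+ t))
        ≈⟨ *-congˡ (solve 2 (λ u v → u :+ v :- u := v) refl (binomialSum h a′ (x ℕ.+ t)) _) ⟩
      h⁻¹ * (h * binomialSum h (λ j → a′ (suc j)) (x ℕ.+ t))       ≈⟨ h⁻¹-cancel _ ⟩
      binomialSum h (λ j → a′ (suc j)) (x ℕ.+ t)
        ≈⟨ binomialSum-cong h (x ℕ.+ t) (λ j → reflexive (≡.cong a (ℕ.+-suc k j))) ⟩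
      binomialSum h (λ j → a (suc k ℕ.+ j)) (x ℕ.+ t)               ∎
      where a′ = λ j → a (k ℕ.+ j)

    newton : ∀ s f → f s ≈ binomialSum h (λ k → ∇^ k f 0) s
    newton zero f = sym (binomialSum-0 h (λ k → ∇^ k f 0))
    newton (suc s) f = begin
      f (suc s)                                                    ≈⟨ newton s (λ y → f (suc y)) ⟩
      binomialSum h (λ k → ∇^ k (λ y → f (suc y)) 0) s
        ≈⟨ binomialSum-cong h s (λ k → trans (reflexive (∇^-shift k f 0)) (∇-step (∇^ k f) 0)) ⟩
      binomialSum h (λ k → ∇^ k f 0 + h * ∇^ (suc k) f 0) s        ≈⟨ binomialSum-+ h _ _ s ⟩
      binomialSum h (λ k → ∇^ k f 0) s + binomialSum h (λ k → h * ∇^ (suc k) f 0) s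
        ≈⟨ +-congˡ (binomialSum-*ˡ h h _ s) ⟩
      binomialSum h (λ k → ∇^ k f 0) s + h * binomialSum h (λ k → ∇^ (suc k) f 0) s
        ≈⟨ binomialSum-suc h _ s ⟨
      binomialSum h (λ k → ∇^ k f 0) (suc s)                        ∎

    module Integrality {b} {B : Carrier → Set b} (B-closed : IsSubsemiring B) (h∈B : B h) where

      open IsSubsemiring B-closed

      Integral : (ℕ → Carrier) → Set b
      Integral f = ∀ k x → B (∇^ k f x)

      integral-resp : ∀ {f g} → (∀ y → f y ≈ g y) → Integral f → Integral g
      integral-resp f≈g f-int k x = ∈-resp-≈ (∇^-cong k f≈g x) (f-int k x)

      integral-shift : ∀ {f} → Integral f → Integral (λ y → f (suc y))
      integral-shift {f} f-int k x = ≡.subst B (≡.sym (∇^-shift k f x)) (f-int k (suc x))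

      integral-∇ : ∀ {f} → Integral f → Integral (∇ f)
      integral-∇ {f} f-int k x = ∈-resp-≈ (∇^-suc k f x) (f-int (suc k) x)

      integral-const : ∀ {a} → B a → Integral (λ _ → a)
      integral-const a∈B zero x = a∈B
      integral-const {a} a∈B (suc k) x = ∈-resp-≈ (sym (∇^-const k a x)) 0∈

      integral-*ˡ : ∀ {a f} → B a → Integral f → Integral (λ y → a * f y)
      integral-*ˡ {a} {f} a∈B f-int k x = ∈-resp-≈ (sym (∇^-*ˡ k a f x)) (*-closed a∈B (f-int k x))

      -- Leibniz rule for ∇; the induction on k is over all pairs f, g at once.
      integral-* : ∀ {f g} → Integral f → Integral g → Integral (λ y → f y * g y)
      integral-* {f} {g} f-int g-int zero x = *-closed (f-int 0 x) (g-int 0 x)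
      integral-* {f} {g} f-int g-int (suc k) x = ∈-resp-≈ (sym leibniz)
        (+-closed (integral-* (integral-∇ f-int) (integral-shift g-int) k x)
                  (integral-* f-int (integral-∇ g-int) k x))
        where
        leibniz : ∇^ (suc k) (λ y → f y * g y) x
                  ≈ ∇^ k (λ y → ∇ f y * g (suc y)) x + ∇^ k (λ y → f y * ∇ g y) x
        leibniz = trans (∇^-suc k _ x) (trans (∇^-cong k (∇-* f g) x) (∇^-+ k _ _ x))

      integral-prod : ∀ m {f : ℕ → ℕ → Carrier} → (∀ i → Integral (f i)) →
                      Integral (λ y → prod m (λ i → f i y))
      integral-prod zero _ = integral-const 1∈
      integral-prod (suc m) f-int = integral-* (integral-prod m f-int) (f-int m)

      integral-geometric : ∀ {e} → B e → Integral (λ y → (1# + h * e) ^ y)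
      integral-geometric {e} e∈B k x = ∈-resp-≈ (sym (∇^-geometric e k x))
        (*-closed (^-closed k e∈B) (^-closed x (+-closed 1∈ (*-closed h∈B e∈B))))

      binomialSum-closed : ∀ {a} l → (∀ j → B (a j)) → B (binomialSum h a l)
      binomialSum-closed l a∈B =
        sum-closed (suc l) λ j → *-closed (×1-closed (l C j)) (*-closed (^-closed j h∈B) (a∈B j))

      integral-binomialSum : ∀ {a} t → (∀ j → B (a j)) → Integral (λ z → binomialSum h a (z ℕ.+ t))
      integral-binomialSum {a} t a∈B k x =
        ∈-resp-≈ (sym (∇^-binomialSum k a t x)) (binomialSum-closed (x ℕ.+ t) λ j → a∈B (k ℕ.+ j))

module Polynomials {c ℓ} (R : CommutativeRing c ℓ) (p n : ℕ) where
  open import Algebra.Bundles using (CommutativeRing; RawRing)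
  open import Data.Nat.Base using (ℕ; zero; suc)
  open import Algebra.Structures using (IsCommutativeRing)
  open import Algebra.Morphism.Structures using (IsRingMonomorphism)
  import Algebra.Morphism.RingMonomorphism as RingMonomorphism
  open import Data.List.Base using (List; []; _∷_; map)
  open import Data.Product.Base using (_,_)
  open import Data.Unit.Base using (tt)
  open import Level using (lift)
  open import Defs
  open Construction R p n

  module OneVariable (k : ℕ)
    (base : IsCommutativeRing (EqP k) (addP k) (mulP k) (negP k) (zeroP k) (oneP k)) where

    private
      module B = IsCommutativeRing base
      _≈_ = EqP k
      _+_ = addP k
      _*_ = mulP k
      0ᵇ = zeroP k
      1ᵇ = oneP k
      infix 4 _≈_
      infixl 6 _+_ _⊕_
      infixl 7 _*_ _⊗_
      _⊕_ = addP (suc k)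
      _⊗_ = mulP (suc k)
      ⊝_ = negP (suc k)
      infix 8 ⊝_
      _·_ : Poly k → Poly (suc k) → Poly (suc k)
      a · xs = map (a *_) xs
      infixr 7 _·_

    -- EqP (suc k) recurses on both lists, so it does not determine them; the record does.
    infix 4 _≋_
    record _≋_ (xs ys : Poly (suc k)) : Set ℓ where
      constructor wrap
      field unwrap : EqP (suc k) xs ys
    open _≋_ public

    private
      ∷-cong : ∀ {x y xs ys} → x ≈ y → xs ≋ ys → (x ∷ xs) ≋ (y ∷ ys)
      ∷-cong x≈y (wrap xs≈ys) = wrap (x≈y , xs≈ys)
      ∷≋[] : ∀ {x xs} → x ≈ 0ᵇ → xs ≋ [] → (x ∷ xs) ≋ []
      ∷≋[] x≈0 (wrap xs≈[]) = wrap (x≈0 , xs≈[])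
      []≋∷ : ∀ {y ys} → 0ᵇ ≈ y → [] ≋ ys → [] ≋ (y ∷ ys)
      []≋∷ 0≈y (wrap []≈ys) = wrap (0≈y , []≈ys)
      head-≈ : ∀ {x y xs ys} → (x ∷ xs) ≋ (y ∷ ys) → x ≈ y
      head-≈ (wrap (x≈y , _)) = x≈y
      tail-≋ : ∀ {x y xs ys} → (x ∷ xs) ≋ (y ∷ ys) → xs ≋ ys
      tail-≋ (wrap (_ , xs≈ys)) = wrap xs≈ys
      head-≈0 : ∀ {x xs} → (x ∷ xs) ≋ [] → x ≈ 0ᵇ
      head-≈0 (wrap (x≈0 , _)) = x≈0
      tail-≋[] : ∀ {x xs} → (x ∷ xs) ≋ [] → xs ≋ []
      tail-≋[] (wrap (_ , xs≈[])) = wrap xs≈[]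
      0≈head : ∀ {y ys} → [] ≋ (y ∷ ys) → 0ᵇ ≈ y
      0≈head (wrap (0≈y , _)) = 0≈y
      []≋tail : ∀ {y ys} → [] ≋ (y ∷ ys) → [] ≋ ys
      []≋tail (wrap (_ , []≈ys)) = wrap []≈ys
      []≋[] : [] ≋ []
      []≋[] = wrap (lift tt)

      ≋-refl : ∀ {xs} → xs ≋ xs
      ≋-refl {[]} = []≋[]
      ≋-refl {x ∷ xs} = ∷-cong B.refl ≋-refl

      ≋-sym : ∀ {xs ys} → xs ≋ ys → ys ≋ xs
      ≋-sym {[]} {[]} _ = []≋[]
      ≋-sym {[]} {y ∷ ys} eq = ∷≋[] (B.sym (0≈head eq)) (≋-sym ([]≋tail eq))
      ≋-sym {x ∷ xs} {[]} eq = []≋∷ (B.sym (head-≈0 eq)) (≋-sym (tail-≋[] eq))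
      ≋-sym {x ∷ xs} {y ∷ ys} eq = ∷-cong (B.sym (head-≈ eq)) (≋-sym (tail-≋ eq))

      ≋-trans : ∀ {xs ys zs} → xs ≋ ys → ys ≋ zs → xs ≋ zs
      ≋-trans {[]} {[]} _ eq = eq
      ≋-trans {[]} {y ∷ ys} {[]} _ _ = []≋[]
      ≋-trans {[]} {y ∷ ys} {z ∷ zs} eq₁ eq₂ =
        []≋∷ (B.trans (0≈head eq₁) (head-≈ eq₂)) (≋-trans ([]≋tail eq₁) (tail-≋ eq₂))
      ≋-trans {x ∷ xs} {[]} {[]} eq _ = eq
      ≋-trans {x ∷ xs} {[]} {z ∷ zs} eq₁ eq₂ =
        ∷-cong (B.trans (head-≈0 eq₁) (0≈head eq₂)) (≋-trans (tail-≋[] eq₁) ([]≋tail eq₂))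
      ≋-trans {x ∷ xs} {y ∷ ys} {[]} eq₁ eq₂ =
        ∷≋[] (B.trans (head-≈ eq₁) (head-≈0 eq₂)) (≋-trans (tail-≋ eq₁) (tail-≋[] eq₂))
      ≋-trans {x ∷ xs} {y ∷ ys} {z ∷ zs} eq₁ eq₂ =
        ∷-cong (B.trans (head-≈ eq₁) (head-≈ eq₂)) (≋-trans (tail-≋ eq₁) (tail-≋ eq₂))

      ⊕-identityʳ : ∀ xs → xs ⊕ [] ≋ xs
      ⊕-identityʳ [] = []≋[]
      ⊕-identityʳ (x ∷ xs) = ≋-refl

      ⊕-comm : ∀ xs ys → xs ⊕ ys ≋ ys ⊕ xs
      ⊕-comm [] [] = []≋[]
      ⊕-comm [] (y ∷ ys) = ≋-refl
      ⊕-comm (x ∷ xs) [] = ≋-refl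
      ⊕-comm (x ∷ xs) (y ∷ ys) = ∷-cong (B.+-comm x y) (⊕-comm xs ys)

      ⊕-assoc : ∀ xs ys zs → (xs ⊕ ys) ⊕ zs ≋ xs ⊕ (ys ⊕ zs)
      ⊕-assoc [] ys zs = ≋-refl
      ⊕-assoc (x ∷ xs) [] zs = ≋-refl
      ⊕-assoc (x ∷ xs) (y ∷ ys) [] = ≋-refl
      ⊕-assoc (x ∷ xs) (y ∷ ys) (z ∷ zs) = ∷-cong (B.+-assoc x y z) (⊕-assoc xs ys zs)

      ⊕-absorbs-[] : ∀ {xs} ys → [] ≋ xs → ys ≋ xs ⊕ ys
      ⊕-absorbs-[] {[]} ys _ = ≋-refl
      ⊕-absorbs-[] {x ∷ xs} [] eq = eq
      ⊕-absorbs-[] {x ∷ xs} (y ∷ ys) eq =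
        ∷-cong (B.trans (B.sym (B.+-identityˡ y)) (B.+-congʳ (0≈head eq))) (⊕-absorbs-[] ys ([]≋tail eq))

      ⊕-congʳ : ∀ {xs xs'} ys → xs ≋ xs' → xs ⊕ ys ≋ xs' ⊕ ys
      ⊕-congʳ {[]} ys eq = ⊕-absorbs-[] ys eq
      ⊕-congʳ {x ∷ xs} {[]} ys eq = ≋-sym (⊕-absorbs-[] ys (≋-sym eq))
      ⊕-congʳ {x ∷ xs} {x' ∷ xs'} [] eq = eq
      ⊕-congʳ {x ∷ xs} {x' ∷ xs'} (y ∷ ys) eq = ∷-cong (B.+-congʳ (head-≈ eq)) (⊕-congʳ ys (tail-≋ eq))

      ⊕-cong : ∀ {xs xs' ys ys'} → xs ≋ xs' → ys ≋ ys' → xs ⊕ ys ≋ xs' ⊕ ys'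
      ⊕-cong {xs} {xs'} {ys} {ys'} eq₁ eq₂ =
        ≋-trans (⊕-congʳ ys eq₁) (≋-trans (⊕-comm xs' ys) (≋-trans (⊕-congʳ xs' eq₂) (⊕-comm ys' xs')))

      ⊕-interchange : ∀ a b x y → (a ⊕ b) ⊕ (x ⊕ y) ≋ (a ⊕ x) ⊕ (b ⊕ y)
      ⊕-interchange a b x y =
        ≋-trans (⊕-assoc a b (x ⊕ y))
          (≋-trans (⊕-cong {a} ≋-refl (≋-trans (≋-sym (⊕-assoc b x y))
             (≋-trans (⊕-cong (⊕-comm b x) (≋-refl {y})) (⊕-assoc x b y))))
             (≋-sym (⊕-assoc a x (b ⊕ y))))

      ⊕-left-comm : ∀ a b x → a ⊕ (b ⊕ x) ≋ b ⊕ (a ⊕ x)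
      ⊕-left-comm a b x = ≋-trans (≋-sym (⊕-assoc a b x))
        (≋-trans (⊕-cong (⊕-comm a b) (≋-refl {x})) (⊕-assoc b a x))

      ⊝-inverseˡ : ∀ xs → ⊝ xs ⊕ xs ≋ []
      ⊝-inverseˡ [] = []≋[]
      ⊝-inverseˡ (x ∷ xs) = ∷≋[] (B.-‿inverseˡ x) (⊝-inverseˡ xs)

      ⊝-inverseʳ : ∀ xs → xs ⊕ ⊝ xs ≋ []
      ⊝-inverseʳ xs = ≋-trans (⊕-comm xs (⊝ xs)) (⊝-inverseˡ xs)

      ⊝-[] : ∀ {xs} → [] ≋ xs → [] ≋ ⊝ xs
      ⊝-[] {[]} _ = []≋[]
      ⊝-[] {x ∷ xs} eq = []≋∷ (B.trans (B.sym -0≈0) (B.-‿cong (0≈head eq))) (⊝-[] ([]≋tail eq))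
        where
        -0≈0 : negP k 0ᵇ ≈ 0ᵇ
        -0≈0 = B.trans (B.sym (B.+-identityʳ (negP k 0ᵇ))) (B.-‿inverseˡ 0ᵇ)

      ⊝-cong : ∀ {xs ys} → xs ≋ ys → ⊝ xs ≋ ⊝ ys
      ⊝-cong {[]} eq = ⊝-[] eq
      ⊝-cong {x ∷ xs} {[]} eq = ≋-sym (⊝-[] (≋-sym eq))
      ⊝-cong {x ∷ xs} {y ∷ ys} eq = ∷-cong (B.-‿cong (head-≈ eq)) (⊝-cong (tail-≋ eq))

      ·-[] : ∀ a {xs} → [] ≋ xs → [] ≋ a · xs
      ·-[] a {[]} _ = []≋[]
      ·-[] a {x ∷ xs} eq = []≋∷ (B.trans (B.sym (B.zeroʳ a)) (B.*-congˡ (0≈head eq))) (·-[] a ([]≋tail eq))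

      ·-congˡ : ∀ a {xs ys} → xs ≋ ys → a · xs ≋ a · ys
      ·-congˡ a {[]} eq = ·-[] a eq
      ·-congˡ a {x ∷ xs} {[]} eq = ≋-sym (·-[] a (≋-sym eq))
      ·-congˡ a {x ∷ xs} {y ∷ ys} eq = ∷-cong (B.*-congˡ (head-≈ eq)) (·-congˡ a (tail-≋ eq))

      ·-congʳ : ∀ {a b} xs → a ≈ b → a · xs ≋ b · xs
      ·-congʳ [] _ = []≋[]
      ·-congʳ (x ∷ xs) a≈b = ∷-cong (B.*-congʳ a≈b) (·-congʳ xs a≈b)

      0·-[] : ∀ xs → [] ≋ 0ᵇ · xs
      0·-[] [] = []≋[]
      0·-[] (x ∷ xs) = []≋∷ (B.sym (B.zeroˡ x)) (0·-[] xs)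

      1·-identity : ∀ xs → 1ᵇ · xs ≋ xs
      1·-identity [] = []≋[]
      1·-identity (x ∷ xs) = ∷-cong (B.*-identityˡ x) (1·-identity xs)

      ·-distribˡ : ∀ a xs ys → a · (xs ⊕ ys) ≋ a · xs ⊕ a · ys
      ·-distribˡ a [] ys = ≋-refl
      ·-distribˡ a (x ∷ xs) [] = ≋-refl
      ·-distribˡ a (x ∷ xs) (y ∷ ys) = ∷-cong (B.distribˡ a x y) (·-distribˡ a xs ys)

      ·-distribʳ : ∀ a b xs → (a + b) · xs ≋ a · xs ⊕ b · xs
      ·-distribʳ a b [] = []≋[]
      ·-distribʳ a b (x ∷ xs) = ∷-cong (B.distribʳ x a b) (·-distribʳ a b xs)

      ·-assoc : ∀ a b xs → a · b · xs ≋ (a * b) · xs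
      ·-assoc a b [] = []≋[]
      ·-assoc a b (x ∷ xs) = ∷-cong (B.sym (B.*-assoc a b x)) (·-assoc a b xs)

      0∷[]≋[] : (0ᵇ ∷ []) ≋ []
      0∷[]≋[] = ∷≋[] B.refl []≋[]

      ⊗-[]ˡ : ∀ {xs} ys → [] ≋ xs → [] ≋ xs ⊗ ys
      ⊗-[]ˡ {[]} ys _ = []≋[]
      ⊗-[]ˡ {x ∷ xs} ys eq =
        ≋-trans {[]} {[] ⊕ []} []≋[]
          (⊕-cong (≋-trans (0·-[] ys) (·-congʳ ys (0≈head eq)))
                  (≋-trans (≋-sym 0∷[]≋[]) (∷-cong B.refl (⊗-[]ˡ ys ([]≋tail eq)))))

      ⊗-congʳ : ∀ {xs xs'} ys → xs ≋ xs' → xs ⊗ ys ≋ xs' ⊗ ys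
      ⊗-congʳ {[]} ys eq = ⊗-[]ˡ ys eq
      ⊗-congʳ {x ∷ xs} {[]} ys eq = ≋-sym (⊗-[]ˡ ys (≋-sym eq))
      ⊗-congʳ {x ∷ xs} {x' ∷ xs'} ys eq =
        ⊕-cong (·-congʳ ys (head-≈ eq)) (∷-cong B.refl (⊗-congʳ ys (tail-≋ eq)))

      ⊗-congˡ : ∀ xs {ys ys'} → ys ≋ ys' → xs ⊗ ys ≋ xs ⊗ ys'
      ⊗-congˡ [] _ = []≋[]
      ⊗-congˡ (x ∷ xs) eq = ⊕-cong (·-congˡ x eq) (∷-cong B.refl (⊗-congˡ xs eq))

      ⊗-cong : ∀ {xs xs' ys ys'} → xs ≋ xs' → ys ≋ ys' → xs ⊗ ys ≋ xs' ⊗ ys'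
      ⊗-cong {xs} {xs'} {ys} eq₁ eq₂ = ≋-trans (⊗-congʳ ys eq₁) (⊗-congˡ xs' eq₂)

      0∷-⊕ : ∀ xs ys → (0ᵇ ∷ (xs ⊕ ys)) ≋ (0ᵇ ∷ xs) ⊕ (0ᵇ ∷ ys)
      0∷-⊕ xs ys = ∷-cong (B.sym (B.+-identityʳ 0ᵇ)) ≋-refl

      ⊗-distribʳ : ∀ xs ys zs → (xs ⊕ ys) ⊗ zs ≋ xs ⊗ zs ⊕ ys ⊗ zs
      ⊗-distribʳ [] ys zs = ≋-refl
      ⊗-distribʳ (x ∷ xs) [] zs = ≋-sym (⊕-identityʳ _)
      ⊗-distribʳ (x ∷ xs) (y ∷ ys) zs =
        ≋-trans (⊕-cong (·-distribʳ x y zs)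
                   (≋-trans (∷-cong B.refl (⊗-distribʳ xs ys zs)) (0∷-⊕ (xs ⊗ zs) (ys ⊗ zs))))
          (⊕-interchange (x · zs) (y · zs) (0ᵇ ∷ xs ⊗ zs) (0ᵇ ∷ ys ⊗ zs))

      ·-⊗ : ∀ a xs ys → a · (xs ⊗ ys) ≋ (a · xs) ⊗ ys
      ·-⊗ a [] ys = []≋[]
      ·-⊗ a (x ∷ xs) ys =
        ≋-trans (·-distribˡ a (x · ys) (0ᵇ ∷ xs ⊗ ys))
          (⊕-cong (·-assoc a x ys) (∷-cong (B.zeroʳ a) (·-⊗ a xs ys)))

      0∷-⊗ : ∀ xs ys → (0ᵇ ∷ xs) ⊗ ys ≋ (0ᵇ ∷ xs ⊗ ys)
      0∷-⊗ xs ys = ⊕-congʳ (0ᵇ ∷ xs ⊗ ys) (≋-sym (0·-[] ys))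

      ⊗-assoc : ∀ xs ys zs → (xs ⊗ ys) ⊗ zs ≋ xs ⊗ (ys ⊗ zs)
      ⊗-assoc [] ys zs = []≋[]
      ⊗-assoc (x ∷ xs) ys zs =
        ≋-trans (⊗-distribʳ (x · ys) (0ᵇ ∷ xs ⊗ ys) zs)
          (⊕-cong (≋-sym (·-⊗ x ys zs))
            (≋-trans (0∷-⊗ (xs ⊗ ys) zs) (∷-cong B.refl (⊗-assoc xs ys zs))))

      ⊗-[]ʳ : ∀ xs → xs ⊗ [] ≋ []
      ⊗-[]ʳ [] = []≋[]
      ⊗-[]ʳ (x ∷ xs) = ∷≋[] B.refl (⊗-[]ʳ xs)

      ⊗-∷ʳ : ∀ xs y ys → xs ⊗ (y ∷ ys) ≋ y · xs ⊕ (0ᵇ ∷ xs ⊗ ys)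
      ⊗-∷ʳ [] y ys = []≋∷ B.refl []≋[]
      ⊗-∷ʳ (x ∷ xs) y ys =
        ∷-cong (B.trans (B.+-identityʳ (x * y)) (B.trans (B.*-comm x y) (B.sym (B.+-identityʳ (y * x)))))
          (≋-trans (⊕-cong (≋-refl {x · ys}) (⊗-∷ʳ xs y ys)) (⊕-left-comm (x · ys) (y · xs) (0ᵇ ∷ xs ⊗ ys)))

      ⊗-comm : ∀ xs ys → xs ⊗ ys ≋ ys ⊗ xs
      ⊗-comm [] ys = ≋-sym (⊗-[]ʳ ys)
      ⊗-comm (x ∷ xs) ys =
        ≋-trans (⊕-cong (≋-refl {x · ys}) (∷-cong B.refl (⊗-comm xs ys))) (≋-sym (⊗-∷ʳ ys x xs))

      ⊗-identityˡ : ∀ xs → (1ᵇ ∷ []) ⊗ xs ≋ xs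
      ⊗-identityˡ xs = ≋-trans (⊕-cong (1·-identity xs) 0∷[]≋[]) (⊕-identityʳ xs)

    isCommutativeRing≋ : IsCommutativeRing _≋_ _⊕_ _⊗_ ⊝_ [] (1ᵇ ∷ [])
    isCommutativeRing≋ = record
      { isRing = record
        { +-isAbelianGroup = record
          { isGroup = record
            { isMonoid = record
              { isSemigroup = record
                { isMagma = record
                  { isEquivalence = record { refl = ≋-refl ; sym = ≋-sym ; trans = ≋-trans }
                  ; ∙-cong = ⊕-cong }
                ; assoc = ⊕-assoc }
              ; identity = (λ _ → ≋-refl) , ⊕-identityʳ }
            ; inverse = ⊝-inverseˡ , ⊝-inverseʳ
            ; ⁻¹-cong = ⊝-cong }
          ; comm = ⊕-comm }
        ; *-cong = ⊗-cong
        ; *-assoc = ⊗-assoc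
        ; *-identity = ⊗-identityˡ , λ xs → ≋-trans (⊗-comm xs _) (⊗-identityˡ xs)
        ; distrib = (λ xs ys zs → ≋-trans (⊗-comm xs (ys ⊕ zs))
                      (≋-trans (⊗-distribʳ ys zs xs) (⊕-cong (⊗-comm ys xs) (⊗-comm zs xs))))
                  , (λ xs ys zs → ⊗-distribʳ ys zs xs) }
      ; *-comm = ⊗-comm }

    private
      rawRingOver : (Poly (suc k) → Poly (suc k) → Set ℓ) → RawRing c ℓ
      rawRingOver _∼_ = record
        { Carrier = Poly (suc k) ; _≈_ = _∼_ ; _+_ = _⊕_ ; _*_ = _⊗_ ; -_ = ⊝_ ; 0# = [] ; 1# = 1ᵇ ∷ [] }

      wrapping : IsRingMonomorphism (rawRingOver (EqP (suc k))) (rawRingOver _≋_) (λ xs → xs)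
      wrapping = record
        { isRingHomomorphism = record
          { isSemiringHomomorphism = record
            { isNearSemiringHomomorphism = record
              { +-isMonoidHomomorphism = record
                { isMagmaHomomorphism = record
                  { isRelHomomorphism = record { cong = wrap }
                  ; homo = λ _ _ → ≋-refl }
                ; ε-homo = []≋[] }
              ; *-homo = λ _ _ → ≋-refl }
            ; 1#-homo = ≋-refl }
          ; -‿homo = λ _ → ≋-refl }
        ; injective = unwrap }

    isCommutativeRing : IsCommutativeRing (EqP (suc k)) _⊕_ _⊗_ ⊝_ [] (1ᵇ ∷ [])
    isCommutativeRing = RingMonomorphism.isCommutativeRing wrapping isCommutativeRing≋

  isCommutativeRing : ∀ k → IsCommutativeRing (EqP k) (addP k) (mulP k) (negP k) (zeroP k) (oneP k)
  isCommutativeRing zero = CommutativeRing.isCommutativeRing R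
  isCommutativeRing (suc k) = OneVariable.isCommutativeRing k (isCommutativeRing k)

  open OneVariable N (isCommutativeRing N) public using (_≋_; wrap; unwrap)

  commutativeRing : CommutativeRing c ℓ
  commutativeRing = record { isCommutativeRing = OneVariable.isCommutativeRing≋ N (isCommutativeRing N) }

  constP-cong : ∀ k {a b} → a R.≈ b → EqP k (constP k a) (constP k b)
  constP-cong zero a≈b = a≈b
  constP-cong (suc k) a≈b = constP-cong k a≈b , lift tt

  constP-0# : ∀ k → EqP k (constP k R.0#) (zeroP k)
  constP-0# zero = R.refl
  constP-0# (suc k) = constP-0# k , lift tt

  constP-+ : ∀ k a b → EqP k (constP k (a R.+ b)) (addP k (constP k a) (constP k b))
  constP-+ zero a b = R.refl
  constP-+ (suc k) a b = constP-+ k a b , lift tt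

module Localisation {c ℓ} (R : CommutativeRing c ℓ) (p n : ℕ) where
  open import Data.Nat.Base using (ℕ; zero; suc) renaming (_+_ to _+ℕ_)
  open import Algebra.Structures using (IsCommutativeRing)
  open import Algebra.Definitions using (Congruent₂; Commutative)
  import Algebra.Consequences.Setoid
  open import Relation.Binary.Bundles using (Setoid)
  open import Relation.Binary.Structures using (IsEquivalence)
  open import Data.Integer.Base using (+_)
  open import Data.Product.Base using (_,_)
  open import Defs
  open Construction R p n
  open Polynomials R p n using (commutativeRing; _≋_; wrap; unwrap)
  open IntegerSolver commutativeRing using (solve; _:+_; _:*_; _:-_; :-_; _:=_; con)
  module A = CommutativeRing commutativeRing
  open A using (_+_; _*_; _-_; -_)
  open import Relation.Binary.Reasoning.Setoid A.setoid

  -- Defs' _≈L_ is not injective in its arguments; the record restores their inference.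
  infix 4 _≃_
  record _≃_ (x y : L) : Set ℓ where
    constructor wrapL
    field unwrapL : x ≈L y
  open _≃_ public

  private
    ^A-homo-* : ∀ a m k → a ^A (m +ℕ k) ≋ (a ^A m) * (a ^A k)
    ^A-homo-* a zero k = A.sym (A.*-identityˡ (a ^A k))
    ^A-homo-* a (suc m) k = A.trans (A.*-congˡ {a} (^A-homo-* a m k)) (A.sym (A.*-assoc a (a ^A m) (a ^A k)))

    unit : ℕ → ℕ → A
    unit u v = (Λ ^A u) * (Δ ^A v)

    unit-+ : ∀ u v u' v' → unit (u +ℕ u') (v +ℕ v') ≋ unit u v * unit u' v'
    unit-+ u v u' v' = begin
      (Λ ^A (u +ℕ u')) * (Δ ^A (v +ℕ v'))        ≈⟨ A.*-cong (^A-homo-* Λ u u') (^A-homo-* Δ v v') ⟩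
      ((Λ ^A u) * (Λ ^A u')) * ((Δ ^A v) * (Δ ^A v'))
        ≈⟨ solve 4 (λ a b x y → (a :* b) :* (x :* y) := (a :* x) :* (b :* y))
             A.refl (Λ ^A u) (Λ ^A u') (Δ ^A v) (Δ ^A v') ⟩
      unit u v * unit u' v'                      ∎

    den-+ : ∀ x y → den (x +L y) ≋ den x * den y
    den-+ x y = unit-+ (eΛ x) (eΔ x) (eΛ y) (eΔ y)

    den-* : ∀ x y → den (x *L y) ≋ den x * den y
    den-* x y = unit-+ (eΛ x) (eΔ x) (eΛ y) (eΔ y)

    cross : L → L → A
    cross x y = num x * den y - num y * den x

    ≃-intro : ∀ {x y} u v → unit u v * cross x y ≋ A.0# → x ≃ y
    ≃-intro u v eq = wrapL (u , v , unwrap eq)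

    ≃-elim : ∀ {x y b} {P : Set b} → x ≃ y → (∀ u v → unit u v * cross x y ≋ A.0# → P) → P
    ≃-elim (wrapL (u , v , vanish)) k = k u v (wrap vanish)

  ≃-cross : ∀ {x y} → num x * den y ≋ num y * den x → x ≃ y
  ≃-cross {x} {y} eq = ≃-intro 0 0 (begin
    unit 0 0 * (num x * den y - num y * den x) ≈⟨ A.*-congˡ {unit 0 0} (A.+-congʳ { - (num y * den x)} eq) ⟩
    unit 0 0 * (num y * den x - num y * den x) ≈⟨ A.*-congˡ {unit 0 0} (A.-‿inverseʳ (num y * den x)) ⟩
    unit 0 0 * A.0#                            ≈⟨ A.zeroʳ (unit 0 0) ⟩
    A.0#                                       ∎)

  private
    ≃-transfer : ∀ {x y x' y'} (k : A) → cross x' y' ≋ k * cross x y → x ≃ y → x' ≃ y'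
    ≃-transfer {x} {y} {x'} {y'} k eq x≃y = ≃-elim x≃y λ u v vanish → ≃-intro u v (begin
      unit u v * cross x' y'       ≈⟨ A.*-congˡ {unit u v} eq ⟩
      unit u v * (k * cross x y)
        ≈⟨ solve 3 (λ w k d → w :* (k :* d) := k :* (w :* d)) A.refl (unit u v) k (cross x y) ⟩
      k * (unit u v * cross x y)   ≈⟨ A.*-congˡ {k} vanish ⟩
      k * A.0#                     ≈⟨ A.zeroʳ k ⟩
      A.0#                         ∎)

    ≃-refl : ∀ {x} → x ≃ x
    ≃-refl = ≃-cross A.refl

    ≃-sym : ∀ {x y} → x ≃ y → y ≃ x
    ≃-sym {x} {y} = ≃-transfer (- A.1#)
      (solve 2 (λ a b → b :- a := :- con (+ 1) :* (a :- b)) A.refl (num x * den y) (num y * den x))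

    ≃-trans : ∀ {x y z} → x ≃ y → y ≃ z → x ≃ z
    ≃-trans {x} {y} {z} x≃y y≃z =
      ≃-elim x≃y λ u₁ v₁ vanish₁ → ≃-elim y≃z λ u₂ v₂ vanish₂ →
      ≃-intro (u₁ +ℕ u₂ +ℕ eΛ y) (v₁ +ℕ v₂ +ℕ eΔ y) (begin
      unit (u₁ +ℕ u₂ +ℕ eΛ y) (v₁ +ℕ v₂ +ℕ eΔ y) * cross x z
        ≈⟨ A.*-congʳ {cross x z} (A.trans (unit-+ (u₁ +ℕ u₂) (v₁ +ℕ v₂) (eΛ y) (eΔ y))
                                          (A.*-congʳ {den y} (unit-+ u₁ v₁ u₂ v₂))) ⟩
      ((unit u₁ v₁ * unit u₂ v₂) * den y) * cross x z
        ≈⟨ solve 8 (λ w₁ w₂ dy nx dz nz dx ny →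
              ((w₁ :* w₂) :* dy) :* ((nx :* dz) :- (nz :* dx))
              := (w₂ :* dz) :* (w₁ :* ((nx :* dy) :- (ny :* dx)))
                 :+ (w₁ :* dx) :* (w₂ :* ((ny :* dz) :- (nz :* dy))))
             A.refl (unit u₁ v₁) (unit u₂ v₂) (den y) (num x) (den z) (num z) (den x) (num y) ⟩
      (unit u₂ v₂ * den z) * (unit u₁ v₁ * cross x y) + (unit u₁ v₁ * den x) * (unit u₂ v₂ * cross y z)
        ≈⟨ A.+-cong (A.*-congˡ {unit u₂ v₂ * den z} vanish₁) (A.*-congˡ {unit u₁ v₁ * den x} vanish₂) ⟩
      (unit u₂ v₂ * den z) * A.0# + (unit u₁ v₁ * den x) * A.0#
        ≈⟨ solve 2 (λ a b → a :* con (+ 0) :+ b :* con (+ 0) := con (+ 0))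
             A.refl (unit u₂ v₂ * den z) (unit u₁ v₁ * den x) ⟩
      A.0# ∎)

  negL : L → L
  negL x = (- num x) /[Λ^ eΛ x Δ^ eΔ x ]

  1L : L
  1L = ι A.1#

  private
    ≃-cross-via : ∀ x y {dx dy} → den x ≋ dx → den y ≋ dy → num x * dy ≋ num y * dx → x ≃ y
    ≃-cross-via x y dx≈ dy≈ eq =
      ≃-cross (A.trans (A.*-congˡ {num x} dy≈) (A.trans eq (A.sym (A.*-congˡ {num y} dx≈))))

    +L-comm : ∀ x y → (x +L y) ≃ (y +L x)
    +L-comm x y = ≃-cross-via (x +L y) (y +L x) (den-+ x y) (den-+ y x)
      (solve 4 (λ nx dx ny dy → (nx :* dy :+ ny :* dx) :* (dy :* dx) := (ny :* dx :+ nx :* dy) :* (dx :* dy))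
         A.refl (num x) (den x) (num y) (den y))

    +L-assoc : ∀ x y z → ((x +L y) +L z) ≃ (x +L (y +L z))
    +L-assoc x y z = ≃-cross-via ((x +L y) +L z) (x +L (y +L z))
      (A.trans (den-+ (x +L y) z) (A.*-congʳ {den z} (den-+ x y)))
      (A.trans (den-+ x (y +L z)) (A.*-congˡ {den x} (den-+ y z)))
      (begin
        num ((x +L y) +L z) * (den x * (den y * den z))
          ≈⟨ A.*-congʳ {den x * (den y * den z)}
               (A.+-congˡ {num (x +L y) * den z} (A.*-congˡ {num z} (den-+ x y))) ⟩
        ((num x * den y + num y * den x) * den z + num z * (den x * den y)) * (den x * (den y * den z))
          ≈⟨ solve 6 (λ nx dx ny dy nz dz →
                ((nx :* dy :+ ny :* dx) :* dz :+ nz :* (dx :* dy)) :* (dx :* (dy :* dz))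
                := (nx :* (dy :* dz) :+ (ny :* dz :+ nz :* dy) :* dx) :* ((dx :* dy) :* dz))
               A.refl (num x) (den x) (num y) (den y) (num z) (den z) ⟩
        (num x * (den y * den z) + (num y * den z + num z * den y) * den x) * ((den x * den y) * den z)
          ≈⟨ A.*-congʳ {(den x * den y) * den z}
               (A.+-congʳ {num (y +L z) * den x} (A.*-congˡ {num x} (den-+ y z))) ⟨
        num (x +L (y +L z)) * ((den x * den y) * den z) ∎)

    +L-identityˡ : ∀ x → (0L +L x) ≃ x
    +L-identityˡ x = ≃-cross
      (solve 2 (λ nx dx → (con (+ 0) :* dx :+ nx :* (con (+ 1) :* con (+ 1))) :* dx := nx :* dx)
        A.refl (num x) (den x))

    negL-inverseˡ : ∀ x → (negL x +L x) ≃ 0L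
    negL-inverseˡ x = ≃-cross
      (solve 3 (λ nx dx d → ((:- nx) :* dx :+ nx :* dx) :* (con (+ 1) :* con (+ 1)) := con (+ 0) :* d)
        A.refl (num x) (den x) (den (negL x +L x)))

    negL-cong : ∀ {x x'} → x ≃ x' → negL x ≃ negL x'
    negL-cong {x} {x'} = ≃-transfer (- A.1#)
      (solve 4 (λ a b a' b' → (:- a) :* b' :- (:- a') :* b := :- con (+ 1) :* (a :* b' :- a' :* b))
        A.refl (num x) (den x) (num x') (den x'))

    +L-congʳ : ∀ {x x'} y → x ≃ x' → (x +L y) ≃ (x' +L y)
    +L-congʳ {x} {x'} y = ≃-transfer (den y * den y) (begin
      cross (x +L y) (x' +L y)
        ≈⟨ A.+-cong (A.*-congˡ {num (x +L y)} (den-+ x' y)) (A.-‿cong (A.*-congˡ {num (x' +L y)} (den-+ x y))) ⟩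
      (num x * den y + num y * den x) * (den x' * den y) - (num x' * den y + num y * den x') * (den x * den y)
        ≈⟨ solve 6 (λ nx dx nx' dx' ny dy →
             (nx :* dy :+ ny :* dx) :* (dx' :* dy) :- (nx' :* dy :+ ny :* dx') :* (dx :* dy)
             := (dy :* dy) :* (nx :* dx' :- nx' :* dx))
           A.refl (num x) (den x) (num x') (den x') (num y) (den y) ⟩
      (den y * den y) * cross x x' ∎)

    *L-congʳ : ∀ {x x'} y → x ≃ x' → (x *L y) ≃ (x' *L y)
    *L-congʳ {x} {x'} y = ≃-transfer (num y * den y) (begin
      cross (x *L y) (x' *L y)
        ≈⟨ A.+-cong (A.*-congˡ {num (x *L y)} (den-* x' y)) (A.-‿cong (A.*-congˡ {num (x' *L y)} (den-* x y))) ⟩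
      (num x * num y) * (den x' * den y) - (num x' * num y) * (den x * den y)
        ≈⟨ solve 6 (λ nx dx nx' dx' ny dy →
             (nx :* ny) :* (dx' :* dy) :- (nx' :* ny) :* (dx :* dy) := (ny :* dy) :* (nx :* dx' :- nx' :* dx))
           A.refl (num x) (den x) (num x') (den x') (num y) (den y) ⟩
      (num y * den y) * cross x x' ∎)

    *L-comm : ∀ x y → (x *L y) ≃ (y *L x)
    *L-comm x y = ≃-cross-via (x *L y) (y *L x) (den-* x y) (den-* y x)
      (solve 4 (λ nx dx ny dy → (nx :* ny) :* (dy :* dx) := (ny :* nx) :* (dx :* dy))
        A.refl (num x) (den x) (num y) (den y))

    *L-assoc : ∀ x y z → ((x *L y) *L z) ≃ (x *L (y *L z))
    *L-assoc x y z = ≃-cross-via ((x *L y) *L z) (x *L (y *L z))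
      (A.trans (den-* (x *L y) z) (A.*-congʳ {den z} (den-* x y)))
      (A.trans (den-* x (y *L z)) (A.*-congˡ {den x} (den-* y z)))
      (solve 6 (λ nx dx ny dy nz dz →
                  ((nx :* ny) :* nz) :* (dx :* (dy :* dz)) := (nx :* (ny :* nz)) :* ((dx :* dy) :* dz))
        A.refl (num x) (den x) (num y) (den y) (num z) (den z))

    *L-identityˡ : ∀ x → (1L *L x) ≃ x
    *L-identityˡ x = ≃-cross (solve 2 (λ nx dx → (con (+ 1) :* nx) :* dx := nx :* dx) A.refl (num x) (den x))

    *L-distribʳ : ∀ x y z → ((y +L z) *L x) ≃ ((y *L x) +L (z *L x))
    *L-distribʳ x y z = ≃-cross-via ((y +L z) *L x) ((y *L x) +L (z *L x))
      (A.trans (den-* (y +L z) x) (A.*-congʳ {den x} (den-+ y z)))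
      (A.trans (den-+ (y *L x) (z *L x)) (A.*-cong (den-* y x) (den-* z x)))
      (begin
        ((num y * den z + num z * den y) * num x) * ((den y * den x) * (den z * den x))
          ≈⟨ solve 6 (λ nx dx ny dy nz dz →
                ((ny :* dz :+ nz :* dy) :* nx) :* ((dy :* dx) :* (dz :* dx))
                := ((ny :* nx) :* (dz :* dx) :+ (nz :* nx) :* (dy :* dx)) :* ((dy :* dz) :* dx))
               A.refl (num x) (den x) (num y) (den y) (num z) (den z) ⟩
        ((num y * num x) * (den z * den x) + (num z * num x) * (den y * den x)) * ((den y * den z) * den x)
          ≈⟨ A.*-congʳ {(den y * den z) * den x}
               (A.+-cong (A.*-congˡ {num y * num x} (den-* z x)) (A.*-congˡ {num z * num x} (den-* y x))) ⟨
        num ((y *L x) +L (z *L x)) * ((den y * den z) * den x) ∎)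

  private
    ≃-isEquivalence : IsEquivalence _≃_
    ≃-isEquivalence = record
      { refl = ≃-refl ; sym = ≃-sym ; trans = ≃-trans }

    ≃-setoid : Setoid c ℓ
    ≃-setoid = record { isEquivalence = ≃-isEquivalence }

    open Algebra.Consequences.Setoid ≃-setoid

    comm∧congʳ⇒cong : ∀ {_∙_ : L → L → L} → Commutative _≃_ _∙_ →
                      (∀ {x x'} y → x ≃ x' → (x ∙ y) ≃ (x' ∙ y)) → Congruent₂ _≃_ _∙_
    comm∧congʳ⇒cong {_∙_} comm congʳ {x} {x'} {y} {y'} x≃x' y≃y' = ≃-trans (congʳ y x≃x')
      (≃-trans (comm x' y) (≃-trans (congʳ x' y≃y') (comm y' x')))

    +L-cong : Congruent₂ _≃_ _+L_
    +L-cong = comm∧congʳ⇒cong +L-comm +L-congʳ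

    *L-cong : Congruent₂ _≃_ _*L_
    *L-cong = comm∧congʳ⇒cong *L-comm *L-congʳ

  isCommutativeRing : IsCommutativeRing _≃_ _+L_ _*L_ negL 0L 1L
  isCommutativeRing = record
    { isRing = record
      { +-isAbelianGroup = record
        { isGroup = record
          { isMonoid = record
            { isSemigroup = record
              { isMagma = record { isEquivalence = ≃-isEquivalence ; ∙-cong = +L-cong }
              ; assoc = +L-assoc }
            ; identity = comm∧idˡ⇒id {_+L_} +L-comm {0L} +L-identityˡ }
          ; inverse = comm∧invˡ⇒inv {_+L_} {negL} {0L} +L-comm negL-inverseˡ
          ; ⁻¹-cong = negL-cong }
        ; comm = +L-comm }
      ; *-cong = *L-cong
      ; *-assoc = *L-assoc
      ; *-identity = comm∧idˡ⇒id {_*L_} *L-comm {1L} *L-identityˡ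
      ; distrib = comm∧distrʳ⇒distr {_*L_} {_+L_} +L-cong *L-comm *L-distribʳ }
    ; *-comm = *L-comm }

  commutativeRingL : CommutativeRing c ℓ
  commutativeRingL = record { isCommutativeRing = isCommutativeRing }

module CanonicalMap {c ℓ} (R : CommutativeRing c ℓ) (p n : ℕ) where
  open import Data.Nat.Base using (ℕ; zero; suc)
  open import Data.Integer.Base using (+_)
  open import Relation.Binary.PropositionalEquality.Core as ≡ using (_≡_)
  open import Defs
  open Construction R p n
  open Polynomials R p n using (commutativeRing; _≋_; wrap; constP-0#; constP-+)
  open Localisation R p n
  open IntegerSolver commutativeRing using (solve; _:+_; _:*_; _:-_; :-_; _:=_; con)
  module Lᴿ = CommutativeRing commutativeRingL
  open FiniteDifferences commutativeRingL using (sum; prod)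
  open import Algebra.Properties.Semiring.Mult Lᴿ.semiring using (_×_)
  open import Algebra.Properties.Semiring.Exp Lᴿ.semiring using (_^_)

  ι-cong : ∀ {a b} → a ≋ b → ι a ≃ ι b
  ι-cong a≋b = ≃-cross (A.*-congʳ {A.1# A.* A.1#} a≋b)

  ι-+ : ∀ a b → ι (a +A b) ≃ ι a +L ι b
  ι-+ a b = ≃-cross (solve 2 (λ a b → (a :+ b) :* 𝟙 := (a :* 𝟙 :+ b :* 𝟙) :* 𝟙) A.refl a b)
    where 𝟙 = con (+ 1) :* con (+ 1)

  ι-* : ∀ a b → ι (a *A b) ≃ ι a *L ι b
  ι-* a b = ≃-cross A.refl

  ι-^ : ∀ a m → ι (a ^A m) ≃ ι a ^ m
  ι-^ a zero = Lᴿ.refl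
  ι-^ a (suc m) = Lᴿ.trans (ι-* a (a ^A m)) (Lᴿ.*-congˡ {ι a} (ι-^ a m))

  ι-natA : ∀ m → ι (natA m) ≃ m × 1L
  ι-natA zero = ι-cong (wrap (constP-0# V))
  ι-natA (suc m) =
    Lᴿ.trans (ι-cong (wrap (constP-+ V _ (ℕ→R m)))) (Lᴿ.trans (ι-+ 1A (natA m)) (Lᴿ.+-congˡ {1L} (ι-natA m)))

  ι-sumA : ∀ m f → ι (sumA m f) ≃ sum m (λ j → ι (f j))
  ι-sumA zero f = Lᴿ.refl
  ι-sumA (suc m) f = Lᴿ.trans (ι-+ (sumA m f) (f m)) (Lᴿ.+-congʳ {ι (f m)} (ι-sumA m f))

  ι-prodA : ∀ m f → ι (prodA m f) ≃ prod m (λ j → ι (f j))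
  ι-prodA zero f = Lᴿ.refl
  ι-prodA (suc m) f = Lᴿ.trans (ι-* (prodA m f) (f m)) (Lᴿ.*-congʳ {ι (f m)} (ι-prodA m f))

  sumL≡sum : ∀ m f → sumL m f ≡ sum m f
  sumL≡sum zero f = ≡.refl
  sumL≡sum (suc m) f = ≡.cong (_+L f m) (sumL≡sum m f)

  -L≃- : ∀ x y → x -L y ≃ x Lᴿ.- y
  -L≃- x y = ≃-cross (solve 5 (λ a b x' y' d → (a :* b :- x' :* y') :* d := (a :* b :+ (:- x') :* y') :* d)
    A.refl (num x) (den y) (num y) (den x) (den (x -L y)))

  ι-Λ^*invΛ^≃1 : ∀ s → ι (Λ ^A s) *L invΛ^ s ≃ 1L
  ι-Λ^*invΛ^≃1 s = ≃-cross (solve 1 (λ l → (l :* 𝟙) :* (𝟙 :* 𝟙) := 𝟙 :* (l :* 𝟙)) A.refl (Λ ^A s))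
    where 𝟙 = con (+ 1)

  Δ⁻¹ : L
  Δ⁻¹ = 1A /[Λ^ 0 Δ^ 1 ]

  ιΔ*Δ⁻¹≃1 : ι Δ *L Δ⁻¹ ≃ 1L
  ιΔ*Δ⁻¹≃1 = ≃-cross (solve 1 (λ δ → (δ :* 𝟙) :* (𝟙 :* 𝟙) := 𝟙 :* (𝟙 :* (δ :* 𝟙))) A.refl Δ)
    where 𝟙 = con (+ 1)

  invD≃ : ∀ s → invD s ≃ ι (Dexcept s) *L Δ⁻¹
  invD≃ s = ≃-cross (solve 2 (λ e δ → e :* (𝟙 :* (δ :* 𝟙)) := (e :* 𝟙) :* (𝟙 :* (δ :* 𝟙))) A.refl (Dexcept s) Δ)
    where 𝟙 = con (+ 1)

module Proposition {c ℓ} (R : CommutativeRing c ℓ) (p n : ℕ) where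
  open import Level using (_⊔_)
  open import Data.Nat.Base using (ℕ; zero; suc; _≤_; _<_; _∸_; z≤n; s≤s) renaming (_+_ to _+ℕ_)
  open import Data.Nat.Properties using (_<?_; _≟_)
  open import Data.Integer.Base using (+_)
  import Data.Nat.Base as ℕ
  import Data.Nat.Properties as ℕ
  open import Data.Nat.Combinatorics using (_C_; nCn≡1)
  open import Data.Nat.Divisibility using (divides)
  open import Data.Nat.Induction using (<-rec)
  open import Data.Nat.Primality using (Prime)
  open import Data.Product.Base using (Σ; _,_; proj₁; proj₂)
  open import Relation.Binary.PropositionalEquality.Core as ≡ using (_≡_)
  open import Relation.Nullary.Decidable.Core using (yes; no)
  open import Relation.Nullary.Negation.Core using (¬_; contradiction)
  open import Defs
  open Construction R p n
  open Polynomials R p n using (commutativeRing; _≋_; wrap; constP-cong; constP-0#)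
  open Localisation R p n
  open CanonicalMap R p n
  open FiniteDifferences commutativeRingL
  open import Algebra.Properties.Semiring.Mult Lᴿ.semiring using (_×_; ×1-homo-*)
  open import Algebra.Properties.CommutativeSemiring.Exp Lᴿ.commutativeSemiring
    using (_^_; ^-congˡ; ^-homo-*; ^-distrib-*)
  open IntegerSolver commutativeRingL using (solve; _:+_; _:*_; _:-_; _:=_; con)
  open PrimePowerBinomial using (prime∣prime-power-C)
  open import Relation.Binary.Reasoning.Setoid Lᴿ.setoid

  open Lᴿ using (_+_; _*_; _-_; -_)

  x : ℕ → L
  x j = ι (XT j)

  Λᴸ : L
  Λᴸ = ι Λ

  d : ℕ → L
  d l = ι (D l)

  x≃0 : ∀ {j} → N ≤ j → x j ≃ 0L
  x≃0 {j} N≤j with j <? N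
  ... | yes j<N = contradiction (ℕ.<-≤-trans j<N N≤j) (ℕ.<-irrefl ≡.refl)
  ... | no _ = Lᴿ.refl

  d≃binomialSum : ∀ l → d l ≃ binomialSum Λᴸ x l
  d≃binomialSum l =
    Lᴿ.trans (ι-sumA (suc l) (λ j → natA (l C j) *A ((Λ ^A j) *A XT j))) (sum-cong (suc l) λ j _ → begin
    ι (natA (l C j) *A ((Λ ^A j) *A XT j))     ≈⟨ ι-* (natA (l C j)) ((Λ ^A j) *A XT j) ⟩
    ι (natA (l C j)) * ι ((Λ ^A j) *A XT j)   ≈⟨ Lᴿ.*-cong (ι-natA (l C j)) (ι-* (Λ ^A j) (XT j)) ⟩
    (l C j) × 1L * (ι (Λ ^A j) * x j)         ≈⟨ Lᴿ.*-congˡ {(l C j) × 1L} (Lᴿ.*-congʳ {x j} (ι-^ Λ j)) ⟩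
    (l C j) × 1L * (Λᴸ ^ j * x j)             ∎)

  Λᴸ^*invΛ^≃1 : ∀ s → Λᴸ ^ s * invΛ^ s ≃ 1L
  Λᴸ^*invΛ^≃1 s = Lᴿ.trans (Lᴿ.*-congʳ {invΛ^ s} (Lᴿ.sym (ι-^ Λ s))) (ι-Λ^*invΛ^≃1 s)

  -- The factors of Dexcept s are a local function of Defs; unification names them.
  private
    Dexcept-factors : Σ (ℕ → ℕ → A) λ F → ∀ s → Dexcept s ≡ prodA N (F s)
    Dexcept-factors = _ , λ s → ≡.refl

    factor : ℕ → ℕ → A
    factor = proj₁ Dexcept-factors

    factor-≢ : ∀ s l → ¬ l ≡ s → ι (factor s l) ≃ d l
    factor-≢ s l l≢s with l ≟ s
    ... | yes l≡s = contradiction l≡s l≢s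
    ... | no _ = Lᴿ.refl

    factor-≡ : ∀ s → ι (factor s s) ≃ 1L
    factor-≡ s with s ≟ s
    ... | yes _ = Lᴿ.refl
    ... | no s≢s = contradiction ≡.refl s≢s

  d*invD≃1 : ∀ {s} → s < N → d s * invD s ≃ 1L
  d*invD≃1 {s} s<N = begin
    d s * invD s                                 ≈⟨ Lᴿ.*-congˡ {d s} (invD≃ s) ⟩
    d s * (ι (Dexcept s) * Δ⁻¹)
      ≈⟨ solve 3 (λ a b e → a :* (b :* e) := (b :* a) :* e) Lᴿ.refl (d s) (ι (Dexcept s)) Δ⁻¹ ⟩
    (ι (Dexcept s) * d s) * Δ⁻¹                  ≈⟨ Lᴿ.*-congʳ {Δ⁻¹} (Lᴿ.*-congʳ {d s} ιDexcept≃) ⟩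
    (prod N (λ l → ι (factor s l)) * d s) * Δ⁻¹
      ≈⟨ Lᴿ.*-congʳ {Δ⁻¹} (prod-punchOut N d (λ l → ι (factor s l)) s<N (factor-≢ s) (factor-≡ s)) ⟩
    prod N d * Δ⁻¹                               ≈⟨ Lᴿ.*-congʳ {Δ⁻¹} (ι-prodA N D) ⟨
    ι Δ * Δ⁻¹                                    ≈⟨ ιΔ*Δ⁻¹≃1 ⟩
    1L                                           ∎
    where
    ιDexcept≃ : ι (Dexcept s) ≃ prod N (λ l → ι (factor s l))
    ιDexcept≃ = Lᴿ.trans (Lᴿ.reflexive (≡.cong ι (proj₂ Dexcept-factors s))) (ι-prodA N (factor s))

  -- A wrapper making membership in B = R[Λ][X_1, …, 1/Δ] an injective type family.
  record InB (x : L) : Set (c ⊔ ℓ) where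
    constructor inB
    field inSubring : InSubring x
  open InB

  ι∈B : ∀ a → InB (ι a)
  ι∈B a = inB (a , 0 , unwrapL (Lᴿ.refl {ι a}))

  invD∈B : ∀ s → InB (invD s)
  invD∈B s = inB (Dexcept s , 1 , unwrapL (Lᴿ.refl {invD s}))

  Δ⁻¹∈B : InB Δ⁻¹
  Δ⁻¹∈B = inB (1A , 1 , unwrapL (Lᴿ.refl {Δ⁻¹}))

  InB-isSubsemiring : IsSubsemiring InB
  InB-isSubsemiring = record
    { ∈-resp-≈ = λ { {x} {y} x≃y (inB (b , m , x≈b)) →
        inB (b , m , unwrapL (Lᴿ.trans (Lᴿ.sym x≃y) (wrapL {x} {b /[Λ^ 0 Δ^ m ]} x≈b))) }
    ; 0∈ = ι∈B 0A
    ; 1∈ = ι∈B 1A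
    ; +-closed = λ { {x} {y} (inB (b₁ , m₁ , x≈b₁)) (inB (b₂ , m₂ , y≈b₂)) →
        inB (num ((b₁ /[Λ^ 0 Δ^ m₁ ]) + (b₂ /[Λ^ 0 Δ^ m₂ ])) , m₁ +ℕ m₂ ,
             unwrapL (Lᴿ.+-cong {x} {b₁ /[Λ^ 0 Δ^ m₁ ]} {y} {b₂ /[Λ^ 0 Δ^ m₂ ]} (wrapL x≈b₁) (wrapL y≈b₂))) }
    ; *-closed = λ { {x} {y} (inB (b₁ , m₁ , x≈b₁)) (inB (b₂ , m₂ , y≈b₂)) →
        inB (b₁ *A b₂ , m₁ +ℕ m₂ ,
             unwrapL (Lᴿ.*-cong {x} {b₁ /[Λ^ 0 Δ^ m₁ ]} {y} {b₂ /[Λ^ 0 Δ^ m₂ ]} (wrapL x≈b₁) (wrapL y≈b₂))) } }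

  μ : L
  μ = invΛ^ 1

  Λᴸ*μ≃1 : Λᴸ * μ ≃ 1L
  Λᴸ*μ≃1 = Lᴿ.trans (Lᴿ.*-congʳ {μ} (Lᴿ.sym (Lᴿ.*-identityʳ Λᴸ))) (Λᴸ^*invΛ^≃1 1)

  open DividedDifferences Λᴸ μ Λᴸ*μ≃1
  open Integrality InB-isSubsemiring (ι∈B Λ)
  open IsSubsemiring InB-isSubsemiring

  P-unfold : ∀ s → P s ≡ step s (table s)
  P-unfold s with s ≟ s
  ... | yes _ = ≡.refl
  ... | no s≢s = contradiction ≡.refl s≢s

  table-below : ∀ {m k} → k < m → table m k ≡ P k
  table-below {suc m} {k} k<1+m with k ≟ m
  ... | yes ≡.refl = ≡.sym (P-unfold k)
  ... | no k≢m = table-below (ℕ.≤∧≢⇒< (ℕ.≤-pred k<1+m) k≢m)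

  module _ (p-prime : Prime p) (char-p : ℕ→R p R.≈ R.0#) where

    NCj≃0 : ∀ j → 0 < j → j < N → (N C j) × 1L ≃ 0L
    NCj≃0 j 0<j j<N with prime∣prime-power-C p-prime n 0<j j<N
    ... | divides q NCj≡q*p = begin
      (N C j) × 1L            ≡⟨ ≡.cong (_× 1L) NCj≡q*p ⟩
      (q ℕ.* p) × 1L          ≈⟨ ×1-homo-* q p ⟩
      q × 1L * p × 1L         ≈⟨ Lᴿ.*-congˡ {q × 1L} (ι-natA p) ⟨
      q × 1L * ι (natA p)     ≈⟨ Lᴿ.*-congˡ {q × 1L} (ι-cong p≋0) ⟩
      q × 1L * 0L             ≈⟨ Lᴿ.zeroʳ (q × 1L) ⟩
      0L                      ∎
      where
      p≋0 : natA p ≋ 0A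
      p≋0 = A.trans (wrap {constP V (ℕ→R p)} {constP V R.0#} (constP-cong V char-p)) (wrap (constP-0# V))

    d-periodic : ∀ i → d (N +ℕ i) ≃ d i
    d-periodic i = Lᴿ.trans (d≃binomialSum (N +ℕ i))
      (Lᴿ.trans (binomialSum-periodic Λᴸ x N NCj≃0 (λ _ → x≃0) i) (Lᴿ.sym (d≃binomialSum i)))

    E : ℕ → L
    E k = prod (N ∸ 1) (λ i → d (k +ℕ suc i))

    d*E≃ιΔ : ∀ {k} → k < N → d k * E k ≃ ι Δ
    d*E≃ιΔ {k} k<N = begin
      d k * E k                               ≡⟨ ≡.cong (λ t → d t * E k) (ℕ.+-identityʳ k) ⟨
      g 0 * prod (N ∸ 1) (λ i → g (suc i))    ≈⟨ prod-head (N ∸ 1) g ⟨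
      prod (suc (N ∸ 1)) g
        ≡⟨ ≡.cong (λ m → prod m g) (ℕ.suc-pred N {{ℕ.>-nonZero (ℕ.≤-<-trans z≤n k<N)}}) ⟩
      prod N g                                ≈⟨ prod-rotate N d d-periodic (ℕ.<⇒≤ k<N) ⟩
      prod N d                                ≈⟨ ι-prodA N D ⟨
      ι Δ                                     ∎
      where g = λ i → d (k +ℕ i)

    invD≃E*Δ⁻¹ : ∀ {k} → k < N → invD k ≃ E k * Δ⁻¹
    invD≃E*Δ⁻¹ {k} k<N = begin
      invD k                                 ≈⟨ Lᴿ.*-identityʳ (invD k) ⟨
      invD k * 1L                            ≈⟨ Lᴿ.*-congˡ {invD k} ιΔ*Δ⁻¹≃1 ⟨
      invD k * (ι Δ * Δ⁻¹)                   ≈⟨ Lᴿ.*-congˡ {invD k} (Lᴿ.*-congʳ {Δ⁻¹} (d*E≃ιΔ k<N)) ⟨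
      invD k * ((d k * E k) * Δ⁻¹)
        ≈⟨ solve 4 (λ a b x y → a :* ((b :* x) :* y) := (b :* a) :* (x :* y)) Lᴿ.refl (invD k) (d k) (E k) Δ⁻¹ ⟩
      (d k * invD k) * (E k * Δ⁻¹)           ≈⟨ Lᴿ.*-congʳ {E k * Δ⁻¹} (d*invD≃1 k<N) ⟩
      1L * (E k * Δ⁻¹)                       ≈⟨ Lᴿ.*-identityˡ (E k * Δ⁻¹) ⟩
      E k * Δ⁻¹                              ∎

    ρ : L
    ρ = 1L + Λᴸ * (x 1 * invD 0)

    G : ℕ → L
    G k = ρ ^ k * (x 0 * (E k * Δ⁻¹))

    G-integral : Integral G
    G-integral = integral-* {ρ ^_} (integral-geometric {x 1 * invD 0} (*-closed (ι∈B (XT 1)) (invD∈B 0)))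
      (integral-*ˡ {x 0} (ι∈B X₁) (integral-* {E} E-integral (integral-const {Δ⁻¹} Δ⁻¹∈B)))
      where
      E-integral : Integral E
      E-integral = integral-prod (N ∸ 1) {λ i k → d (k +ℕ suc i)} λ i →
        integral-resp (λ k → Lᴿ.sym (d≃binomialSum (k +ℕ suc i)))
                      (integral-binomialSum {x} (suc i) λ j → ι∈B (XT j))

    G≃ : ∀ {k} → k < N → G k ≃ ρ ^ k * (x 0 * invD k)
    G≃ {k} k<N = Lᴿ.*-congˡ {ρ ^ k} (Lᴿ.*-congˡ {x 0} (Lᴿ.sym (invD≃E*Δ⁻¹ k<N)))

    γ : ℕ → L
    γ k = ∇^ k G 0

    γ∈B : ∀ k → InB (γ k)
    γ∈B k = G-integral k 0

    module _ (2<N : 2 < N) where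

      x₀*invD₀≃1 : x 0 * invD 0 ≃ 1L
      x₀*invD₀≃1 = Lᴿ.trans (Lᴿ.*-congʳ {invD 0} x₀≃d₀) (d*invD≃1 (ℕ.<-trans (s≤s z≤n) 2<N))
        where
        x₀≃d₀ : x 0 ≃ d 0
        x₀≃d₀ = Lᴿ.sym (Lᴿ.trans (d≃binomialSum 0) (binomialSum-0 Λᴸ x))

      ρ*x₀≃x₀+Λx₁ : ρ * x 0 ≃ x 0 + Λᴸ * x 1
      ρ*x₀≃x₀+Λx₁ = begin
        ρ * x 0
          ≈⟨ solve 4 (λ l y i v → (con (+ 1) :+ l :* (y :* i)) :* v := v :+ (l :* y) :* (v :* i))
               Lᴿ.refl Λᴸ (x 1) (invD 0) (x 0) ⟩
        x 0 + (Λᴸ * x 1) * (x 0 * invD 0)          ≈⟨ Lᴿ.+-congˡ {x 0} (Lᴿ.*-congˡ {Λᴸ * x 1} x₀*invD₀≃1) ⟩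
        x 0 + (Λᴸ * x 1) * 1L                      ≈⟨ Lᴿ.+-congˡ {x 0} (Lᴿ.*-identityʳ (Λᴸ * x 1)) ⟩
        x 0 + Λᴸ * x 1                             ∎

      ρ*x₀≃d₁ : ρ * x 0 ≃ d 1
      ρ*x₀≃d₁ = Lᴿ.trans ρ*x₀≃x₀+Λx₁ (Lᴿ.sym (Lᴿ.trans (d≃binomialSum 1) (binomialSum-1 Λᴸ x)))

      γ₀≃1 : γ 0 ≃ 1L
      γ₀≃1 = Lᴿ.trans (G≃ (ℕ.<-trans (s≤s z≤n) 2<N)) (Lᴿ.trans (Lᴿ.*-identityˡ (x 0 * invD 0)) x₀*invD₀≃1)

      γ₁≃0 : γ 1 ≃ 0L
      γ₁≃0 = begin
        μ * (G 1 - G 0)    ≈⟨ Lᴿ.*-congˡ {μ} (Lᴿ.+-cong G₁≃1 (Lᴿ.-‿cong γ₀≃1)) ⟩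
        μ * (1L - 1L)      ≈⟨ solve 1 (λ m → m :* (con (+ 1) :- con (+ 1)) := con (+ 0)) Lᴿ.refl μ ⟩
        0L                 ∎
        where
        G₁≃1 : G 1 ≃ 1L
        G₁≃1 = begin
          G 1                          ≈⟨ G≃ (ℕ.<-trans (ℕ.n<1+n 1) 2<N) ⟩
          (ρ * 1L) * (x 0 * invD 1)
            ≈⟨ solve 3 (λ r v i → (r :* con (+ 1)) :* (v :* i) := (r :* v) :* i) Lᴿ.refl ρ (x 0) (invD 1) ⟩
          (ρ * x 0) * invD 1           ≈⟨ Lᴿ.*-congʳ {invD 1} ρ*x₀≃d₁ ⟩
          d 1 * invD 1                 ≈⟨ d*invD≃1 (ℕ.<-trans (ℕ.n<1+n 1) 2<N) ⟩
          1L                           ∎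

      T : ℕ → ℕ → L
      T s k = (s C k) × 1L * (Λᴸ ^ k * γ k)

      G-expansion : ∀ t → G (2 +ℕ t) ≃ 1L + (sum t (λ j → T (2 +ℕ t) (2 +ℕ j)) + Λᴸ ^ (2 +ℕ t) * γ (2 +ℕ t))
      G-expansion t = begin
        G s                                             ≈⟨ newton s G ⟩
        sum (suc s) (T s)                               ≈⟨ sum-head (suc (suc t)) (T s) ⟩
        T s 0 + sum (suc (suc t)) (λ j → T s (suc j))
          ≈⟨ Lᴿ.+-congˡ {T s 0} (sum-head (suc t) (λ j → T s (suc j))) ⟩
        T s 0 + (T s 1 + (Σ′ + T s s))                  ≈⟨ Lᴿ.+-cong T₀≃1 (Lᴿ.+-cong T₁≃0 (Lᴿ.+-congˡ {Σ′} Tₛ≃)) ⟩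
        1L + (0L + (Σ′ + Λᴸ ^ s * γ s))                 ≈⟨ Lᴿ.+-congˡ {1L} (Lᴿ.+-identityˡ (Σ′ + Λᴸ ^ s * γ s)) ⟩
        1L + (Σ′ + Λᴸ ^ s * γ s)                        ∎
        where
        s = 2 +ℕ t
        Σ′ = sum t (λ j → T s (2 +ℕ j))
        T₀≃1 : T s 0 ≃ 1L
        T₀≃1 = Lᴿ.trans (Lᴿ.*-congˡ {1 × 1L} (Lᴿ.*-congˡ {1L} γ₀≃1))
          (solve 0 (((con (+ 1) :+ con (+ 0)) :* (con (+ 1) :* con (+ 1))) := con (+ 1)) Lᴿ.refl)
        T₁≃0 : T s 1 ≃ 0L
        T₁≃0 = Lᴿ.trans (Lᴿ.*-congˡ {(s C 1) × 1L} (Lᴿ.*-congˡ {Λᴸ ^ 1} γ₁≃0))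
          (solve 2 (λ v l → v :* (l :* con (+ 0)) := con (+ 0)) Lᴿ.refl ((s C 1) × 1L) (Λᴸ ^ 1))
        Tₛ≃ : T s s ≃ Λᴸ ^ s * γ s
        Tₛ≃ = Lᴿ.trans (Lᴿ.*-congʳ {Λᴸ ^ s * γ s} (Lᴿ.reflexive (≡.cong (_× 1L) (nCn≡1 s))))
          (solve 1 (λ v → (con (+ 1) :+ con (+ 0)) :* v := v) Lᴿ.refl (Λᴸ ^ s * γ s))

      leading≃ : ∀ {s} → s < N → ι (((X₁ +A (Λ *A XT 1)) ^A s) *A X₁) *L invD s ≃ x 0 ^ s * G s
      leading≃ {s} s<N = begin
        ι ((Y ^A s) *A X₁) * invD s
          ≈⟨ Lᴿ.*-congʳ {invD s} (Lᴿ.trans (ι-* (Y ^A s) X₁) (Lᴿ.*-congʳ {x 0} (ι-^ Y s))) ⟩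
        (ι Y ^ s * x 0) * invD s           ≈⟨ Lᴿ.*-congʳ {invD s} (Lᴿ.*-congʳ {x 0} (^-congˡ s ιY≃ρ*x₀)) ⟩
        ((ρ * x 0) ^ s * x 0) * invD s     ≈⟨ Lᴿ.*-congʳ {invD s} (Lᴿ.*-congʳ {x 0} (^-distrib-* ρ (x 0) s)) ⟩
        ((ρ ^ s * x 0 ^ s) * x 0) * invD s
          ≈⟨ solve 4 (λ r v y i → ((r :* v) :* y) :* i := v :* (r :* (y :* i)))
               Lᴿ.refl (ρ ^ s) (x 0 ^ s) (x 0) (invD s) ⟩
        x 0 ^ s * (ρ ^ s * (x 0 * invD s)) ≈⟨ Lᴿ.*-congˡ {x 0 ^ s} (G≃ s<N) ⟨
        x 0 ^ s * G s                      ∎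
        where
        Y = X₁ +A (Λ *A XT 1)
        ιY≃ρ*x₀ : ι Y ≃ ρ * x 0
        ιY≃ρ*x₀ = Lᴿ.trans (ι-+ X₁ (Λ *A XT 1)) (Lᴿ.trans (Lᴿ.+-congˡ {x 0} (ι-* Λ (XT 1))) (Lᴿ.sym ρ*x₀≃x₀+Λx₁))

      ClosedForm : ℕ → Set ℓ
      ClosedForm s = P s ≃ x 0 ^ s * γ s

      correction≃ : ∀ t → (∀ j → j < t → ClosedForm (2 +ℕ j)) →
                    sumL t (λ j → ι ((natA ((2 +ℕ t) C (2 +ℕ j)) *A (Λ ^A (2 +ℕ j))) *A (X₁ ^A (t ∸ j)))
                                  *L table (2 +ℕ t) (2 +ℕ j))
                    ≃ x 0 ^ (2 +ℕ t) * sum t (λ j → T (2 +ℕ t) (2 +ℕ j))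
      correction≃ t closed = Lᴿ.trans (Lᴿ.reflexive (sumL≡sum t _))
        (Lᴿ.trans (sum-cong t term≃) (sum-*ˡ t (x 0 ^ s) (λ j → T s (2 +ℕ j))))
        where
        s = 2 +ℕ t
        term≃ : ∀ j → j < t → ι ((natA (s C (2 +ℕ j)) *A (Λ ^A (2 +ℕ j))) *A (X₁ ^A (t ∸ j))) * table s (2 +ℕ j)
                              ≃ x 0 ^ s * T s (2 +ℕ j)
        term≃ j j<t = begin
          ι ((natA (s C k) *A (Λ ^A k)) *A (X₁ ^A (t ∸ j))) * table s k
            ≈⟨ Lᴿ.*-congʳ {table s k} (Lᴿ.trans (ι-* (natA (s C k) *A (Λ ^A k)) (X₁ ^A (t ∸ j)))
                 (Lᴿ.*-cong (Lᴿ.trans (ι-* (natA (s C k)) (Λ ^A k)) (Lᴿ.*-cong (ι-natA (s C k)) (ι-^ Λ k)))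
                            (ι-^ X₁ (t ∸ j)))) ⟩
          coeff * table s k       ≡⟨ ≡.cong (coeff *_) (table-below (s≤s (s≤s j<t))) ⟩
          coeff * P k             ≈⟨ Lᴿ.*-congˡ {coeff} (closed j j<t) ⟩
          coeff * (x 0 ^ k * γ k)
            ≈⟨ solve 5 (λ v l a b g → ((v :* l) :* a) :* (b :* g) := (a :* b) :* (v :* (l :* g))) Lᴿ.refl
                 ((s C k) × 1L) (Λᴸ ^ k) (x 0 ^ (t ∸ j)) (x 0 ^ k) (γ k) ⟩
          (x 0 ^ (t ∸ j) * x 0 ^ k) * T s k    ≈⟨ Lᴿ.*-congʳ {T s k} (^-homo-* (x 0) (t ∸ j) k) ⟨
          x 0 ^ ((t ∸ j) +ℕ k) * T s k         ≡⟨ ≡.cong (λ m → x 0 ^ m * T s k) exponent ⟩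
          x 0 ^ s * T s k                      ∎
          where
          k = 2 +ℕ j
          coeff = (s C k) × 1L * Λᴸ ^ k * x 0 ^ (t ∸ j)
          exponent : (t ∸ j) +ℕ k ≡ s
          exponent = ≡.trans (ℕ.+-comm (t ∸ j) k) (≡.cong (2 +ℕ_) (ℕ.m+[n∸m]≡n (ℕ.<⇒≤ j<t)))

      closedForm-step : ∀ t → (∀ j → j < t → ClosedForm (2 +ℕ j)) → 2 +ℕ t < N → ClosedForm (2 +ℕ t)
      closedForm-step t closed s<N = begin
        P s                                                    ≡⟨ P-unfold s ⟩
        invΛ^ s *L ((leading -L ι (X₁ ^A s)) -L correction)
          ≈⟨ Lᴿ.*-congˡ {invΛ^ s} (Lᴿ.trans (-L≃- (leading -L ι (X₁ ^A s)) correction)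
                                            (Lᴿ.+-congʳ { - correction} (-L≃- leading (ι (X₁ ^A s))))) ⟩
        invΛ^ s * ((leading - ι (X₁ ^A s)) - correction)
          ≈⟨ Lᴿ.*-congˡ {invΛ^ s} (Lᴿ.+-cong (Lᴿ.+-cong (leading≃ s<N) (Lᴿ.-‿cong (ι-^ X₁ s)))
                                             (Lᴿ.-‿cong (correction≃ t closed))) ⟩
        invΛ^ s * ((X * G s - X) - X * Σ′)
          ≈⟨ Lᴿ.*-congˡ {invΛ^ s}
               (Lᴿ.+-congʳ { - (X * Σ′)} (Lᴿ.+-congʳ { - X} (Lᴿ.*-congˡ {X} (G-expansion t)))) ⟩
        invΛ^ s * ((X * (1L + (Σ′ + Λᴸ ^ s * γ s)) - X) - X * Σ′)
          ≈⟨ solve 5 (λ i v σ l g → i :* ((v :* (con (+ 1) :+ (σ :+ l :* g)) :- v) :- v :* σ)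
                                    := (l :* i) :* (v :* g))
               Lᴿ.refl (invΛ^ s) X Σ′ (Λᴸ ^ s) (γ s) ⟩
        (Λᴸ ^ s * invΛ^ s) * (X * γ s)                         ≈⟨ Lᴿ.*-congʳ {X * γ s} (Λᴸ^*invΛ^≃1 s) ⟩
        1L * (X * γ s)                                         ≈⟨ Lᴿ.*-identityˡ (X * γ s) ⟩
        X * γ s                                                ∎
        where
        s = 2 +ℕ t
        X = x 0 ^ s
        Σ′ = sum t (λ j → T s (2 +ℕ j))
        leading = ι (((X₁ +A (Λ *A XT 1)) ^A s) *A X₁) *L invD s
        correction = sumL t λ j →
          ι ((natA (s C (2 +ℕ j)) *A (Λ ^A (2 +ℕ j))) *A (X₁ ^A (t ∸ j))) *L table s (2 +ℕ j)

      closedForm : ∀ t → 2 +ℕ t < N → ClosedForm (2 +ℕ t)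
      closedForm = <-rec _ λ t rec s<N →
        closedForm-step t (λ j j<t → rec j<t (ℕ.<-trans (s≤s (s≤s j<t)) s<N)) s<N

  P∈InSubring : Prime p → ℕ→R p R.≈ R.0# → ∀ {s} → 2 ≤ s → s < N → InSubring (P s)
  P∈InSubring p-prime char-p {suc (suc t)} 2≤s s<N =
    inSubring (∈-resp-≈ (Lᴿ.sym (closedForm p-prime char-p (ℕ.≤-<-trans 2≤s s<N) t s<N))
                        (*-closed (^-closed (2 +ℕ t) (ι∈B X₁)) (γ∈B p-prime char-p (2 +ℕ t))))
  P∈InSubring _ _ {suc zero} (s≤s ())

open import Defs
open import Algebra.Bundles using (CommutativeRing)
open import Data.Nat using (ℕ; _≤_; _^_; _∸_)
open import Data.Nat.Primality using (Prime; prime⇒nonZero)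
open import Data.Nat.Properties using (m^n≢0; m≤pred[n]⇒suc[m]≤n)

proposition3p4 : ∀ {c ℓ} (R : CommutativeRing c ℓ) (p n : ℕ) → Prime p → 1 ≤ n →
    CommutativeRing._≈_ R (Construction.ℕ→R R p n p) (CommutativeRing.0# R) →
    ∀ (s : ℕ) → 2 ≤ s → s ≤ p ^ n ∸ 1 →
    Construction.InSubring R p n (Construction.P R p n s)
proposition3p4 R p n p-prime _ char-p s 2≤s s≤p^n∸1 =
  Proposition.P∈InSubring R p n p-prime char-p 2≤s
    (m≤pred[n]⇒suc[m]≤n {{m^n≢0 p n {{prime⇒nonZero p-prime}}}} s≤p^n∸1)
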